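{- Suppose sampleFromADD is invoked with $i < \log_2 N$, $\omega[lo] = s_{j_1}$ and $\omega[hi] = s_{j_3}$. Let $M$ denote the random state returned by sampleFromADD for $\omega[mid]$, where $mid = (lo+hi)/2$. Then for all $s_{j_2}\in S$, we have $\Pr\big[M = s_{j_2} ~\big|~ \omega[lo] = s_{j_1},\omega[hi] = s_{j_3}\big] = \frac{c_{i-1}(s_{j_1},s_{j_2})\times c_{i-1}(s_{j_2},s_{j_3})}{c_{i}(s_{j_1},s_{j_3})}$.
   Context: Consider a deterministic transition system $(S,\Sigma,t,I,F)$ with state set $S=\{0,1\}^k$ over Boolean state variables $X$, initial states $I$ and final (target) states $F$ (with characteristic function $f$). The trace length $N$ is a power of 2. For $l \ge 0$ and states $s,s'\in S$, $c_l(s,s')$ denotes the number of traces (state sequences) of length $2^l$ starting in state $s$ and ending in state $s'$; thus $c_0(s,s')\in\{0,1\}$ and $c_l(s,s') = \sum_{s''\in S} c_{l-1}(s,s'')\,c_{l-1}(s'',s')$. The procedure makeADDs computes, by iterative squaring of the 1-step transition relation $t_0$, Algebraic Decision Diagrams $t_1,\ldots,t_{\log_2 N}$ over state-variable copies $X^0, X^i, X^{i+1}$ such that $t_i(s_{j_1},s_{j_2},s_{j_3}) = c_{i-1}(s_{j_1},s_{j_2})\times c_{i-1}(s_{j_2},s_{j_3})$ for all states (for $t_{\log_2 N}$, additionally conjoined with $I(X^0)$ and $f(X^{\log_2 N+1})$). The procedure sampleFromADD$(i, t_i, lo, hi, \omega)$, given a partially sampled trace $\omega$ and trace indices $lo<hi$,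 works as follows: if $i<\log_2 N$ it substitutes the already-sampled states $\omega[lo]$ and $\omega[hi]$ into $t_i$ to obtain an ADD $\hat t$ (if $i=\log_2 N$, $\hat t = t_i$); it samples a leaf $v$ of $\hat t$ with probability proportional to $val(v)\cdot|\Pi_v|$, where $val(v)$ is the leaf value and $|\Pi_v|$ is the number of paths from $v$ to the root; it then walks up to the root, repeatedly choosing a parent $p$ of the current node $v$ with probability proportional to $2^{level(p)-level(v)-1}\cdot|\Pi_p|$, setting the corresponding state-variable bit of the trace according to the edge taken and assigning uniformly random bits to variables on skipped levels; it returns $\omega[lo],\omega[mid],\omega[hi]$ with $mid=(lo+hi)/2$. -}

module Defs where

open import Data.Bool using (Bool; true; false; if_then_else_)
open import Data.Nat using (ℕ; zero; suc; _+_; _*_; _∸_; _^_; _<_; _<?_)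
open import Data.Fin using (Fin; toℕ)
import Data.Fin as F
open import Data.Vec using (Vec; []; _∷_; lookup; _[_]≔_; replicate)
open import Data.Vec.Properties using (≡-dec)
open import Data.List using (List; []; _∷_; map; concatMap; foldr; filter; allFin)
open import Data.Nat.ListAction using (sum)
open import Data.Integer using (+_)
open import Data.Rational using (ℚ; 0ℚ; 1ℚ; _/_) renaming (_+_ to _+ℚ_; _*_ to _*ℚ_)
open import Data.Product using (Σ; _×_; _,_; proj₁; proj₂)
open import Relation.Nullary using (Dec; yes; no; ¬_)
open import Relation.Nullary.Decidable using (_×-dec_)
open import Relation.Binary.PropositionalEquality using (_≡_)
import Data.Bool.Properties as BP

State : ℕ → Set
State k = Vec Bool k

allStates : (k : ℕ) → List (State k)
allStates zero    = [] ∷ []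
allStates (suc k) = concatMap (λ s → (false ∷ s) ∷ (true ∷ s) ∷ []) (allStates k)

_≟S_ : ∀ {k} (s s' : State k) → Dec (s ≡ s')
_≟S_ = ≡-dec BP._≟_

-- one-step transition relation t₀ (characteristic function): c₀(s,s') ∈ {0,1}
Trans : ℕ → Set
Trans k = State k → State k → Bool

-- c l s s' = number of traces of length 2^l from s to s'
c : ∀ {k} → Trans k → ℕ → State k → State k → ℕ
c t zero    s s' = if t s s' then 1 else 0
c {k} t (suc l) s s' = sum (map (λ s'' → c t l s s'' * c t l s'' s') (allStates k))

Dist : Set → Set
Dist A = List (A × ℚ)

return : ∀ {A : Set} → A → Dist A
return a = (a , 1ℚ) ∷ []

_>>=_ : ∀ {A B : Set} → Dist A → (A → Dist B) → Dist B
d >>= f = concatMap (λ ap → map (λ bq → proj₁ bq , proj₂ ap *ℚ proj₂ bq) (f (proj₁ ap))) d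

choose : ∀ {A : Set} → List (A × ℕ) → Dist A
choose {A} xs with sum (map proj₂ xs)
... | zero    = []
... | suc tot = map (λ aw → proj₁ aw , (+ proj₂ aw) / suc tot) xs

Pr : ∀ {A : Set} → Dist A → (P : A → Set) → (∀ a → Dec (P a)) → ℚ
Pr d P P? = foldr (λ ap acc → (if does (P? (proj₁ ap)) then proj₂ ap else 0ℚ) +ℚ acc) 0ℚ d
  where open Relation.Nullary using (does)

coin : Dist Bool
coin = choose ((false , 1) ∷ (true , 1) ∷ [])

-- Algebraic Decision Diagrams over the k variables of one copy X^i
-- (variable order: index 0 is topmost).  Levels are counted from the
-- bottom: leaves have level 0, a node labelled by variable x has level k ∸ x.

data Node (k n : ℕ) : Set where
  leaf : ℕ → Node k n
  node : Fin k → (lo hi : Fin n) → Node k n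

record ADD (k : ℕ) : Set where
  field
    size  : ℕ
    nodes : Fin size → Node k size
    root  : Fin size
open ADD public

level : ∀ {k n} → Node k n → ℕ
level (leaf _)     = 0
level {k} (node x _ _) = k ∸ toℕ x

lvl : ∀ {k} (D : ADD k) → Fin (size D) → ℕ
lvl D v = level (nodes D v)

Ordered : ∀ {k} → ADD k → Set
Ordered D = ∀ p x l h → nodes D p ≡ node x l h → (lvl D l < lvl D p) × (lvl D h < lvl D p)

Reduced : ∀ {k} → ADD k → Set
Reduced D = (∀ p x l h → nodes D p ≡ node x l h → ¬ (l ≡ h))
          × (∀ p q → nodes D p ≡ nodes D q → p ≡ q)

data Reach {k} (D : ADD k) : Fin (size D) → Set where
  here  : Reach D (root D)
  viaLo : ∀ {p x l h} → Reach D p → nodes D p ≡ node x l h → Reach D l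
  viaHi : ∀ {p x l h} → Reach D p → nodes D p ≡ node x l h → Reach D h

WellFormedADD : ∀ {k} → ADD k → Set
WellFormedADD D = Ordered D × Reduced D × (∀ v → Reach D v)

-- semantics (fuel k+1 suffices for ordered ADDs)
evalFrom : ∀ {k} (D : ADD k) → ℕ → State k → Fin (size D) → ℕ
evalFrom D zero    s v = 0
evalFrom D (suc f) s v with nodes D v
... | leaf a     = a
... | node x l h = if lookup s x then evalFrom D f s h else evalFrom D f s l

eval : ∀ {k} → ADD k → State k → ℕ
eval {k} D s = evalFrom D (suc k) s (root D)

-- edges into v: (parent p, its variable x, bit b of the edge taken)
parentEdges : ∀ {k} (D : ADD k) → Fin (size D) → List (Fin (size D) × Fin k × Bool)
parentEdges D v = concatMap edges (allFin (size D))
  where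
  edges : Fin (size D) → List (Fin (size D) × Fin _ × Bool)
  edges p with nodes D p
  ... | leaf _     = []
  ... | node x l h = (if does (l F.≟ v) then (p , x , false) ∷ [] else [])
                   Data.List.++ (if does (h F.≟ v) then (p , x , true) ∷ [] else [])
    where open Relation.Nullary using (does)

gap : ∀ {k} (D : ADD k) → Fin (size D) → Fin (size D) → ℕ
gap D p v = lvl D p ∸ lvl D v ∸ 1

-- |Π_v|: number of paths from the root to v, where a path crossing
-- skipped levels is counted once per valuation of the skipped variables
PiFrom : ∀ {k} (D : ADD k) → ℕ → Fin (size D) → ℕ
PiFrom D zero    v = 0
PiFrom D (suc f) v =
  (if does (v F.≟ root D) then 1 else 0)
  + sum (map (λ e → 2 ^ gap D (proj₁ e) v * PiFrom D f (proj₁ e)) (parentEdges D v))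
  where open Relation.Nullary using (does)

Pi : ∀ {k} (D : ADD k) → Fin (size D) → ℕ
Pi {k} D v = PiFrom D (suc k) v

skipped : (k lv lp : ℕ) → List (Fin k)
skipped k lv lp = filter (λ j → (lv <? (k ∸ toℕ j)) ×-dec ((k ∸ toℕ j) <? lp)) (allFin k)

uniformBits : ∀ {k} → List (Fin k) → State k → Dist (State k)
uniformBits []       ω = return ω
uniformBits (j ∷ js) ω = coin >>= λ b → uniformBits js (ω [ j ]≔ b)

walkUp : ∀ {k} (D : ADD k) → ℕ → Fin (size D) → State k → Dist (State k)
walkUp D zero v ω = []
walkUp {k} D (suc f) v ω with v F.≟ root D
... | yes _ = uniformBits (skipped k (lvl D v) (suc k)) ω
... | no  _ =
  choose (map (λ e → e , 2 ^ gap D (proj₁ e) v * Pi D (proj₁ e)) (parentEdges D v)) >>= λ e →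
  uniformBits (skipped k (lvl D v) (lvl D (proj₁ e))) (ω [ proj₁ (proj₂ e) ]≔ proj₂ (proj₂ e)) >>= λ ω' →
  walkUp D f (proj₁ e) ω'

leafWeights : ∀ {k} (D : ADD k) → List (Fin (size D) × ℕ)
leafWeights D = concatMap w (allFin (size D))
  where
  w : Fin (size D) → List (Fin (size D) × ℕ)
  w v with nodes D v
  ... | leaf a     = (v , a * Pi D v) ∷ []
  ... | node _ _ _ = []

sampleADD : ∀ {k} → ADD k → Dist (State k)
sampleADD {k} D = choose (leafWeights D) >>= λ v → walkUp D (suc k) v (replicate k false)

-- sampleFromADD in the case i < log₂ N: `That` is the ADD obtained from t_i by
-- substituting ω[lo] = s₁ and ω[hi] = s₃; returns (ω[lo], ω[mid], ω[hi])
sampleFromADD : ∀ {k} → (tHat : ADD k) → (s₁ s₃ : State k) → Dist (State k × State k × State k)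
sampleFromADD tHat s₁ s₃ = sampleADD tHat >>= λ m → return (s₁ , m , s₃)

midIs : ∀ {k} → State k → State k × State k × State k → Set
midIs s₂ r = proj₁ (proj₂ r) ≡ s₂

midIs? : ∀ {k} (s₂ : State k) r → Dec (midIs s₂ r)
midIs? s₂ r = proj₁ (proj₂ r) ≟S s₂

-- Fix a target valuation s, let R = k ∸ level (root D) and write Π v for Pi D v. Climbing from
-- a node v with current valuation ω, the probability of ending at s, multiplied by Π v · 2^R,
-- equals [ω agrees with s on all levels ≤ level v] · [the evaluation path of s visits v]. Indeed
-- a parent edge (p, x, b) is taken with weight 2^gap · Π p, the gap uniform bits drawn on the
-- skipped levels average the agreement there to 2^-gap, cancelling that factor, and summing
-- over the edges into v is flow conservation along the evaluation path of s. Starting from a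
-- leaf drawn with weight val · Π, this gives Pr[s] · Z · 2^R = eval s, with Z the total leaf
-- weight. The walk also preserves total mass, so summing over s identifies Z · 2^R with
-- Σ_s eval s = c_i(s₁, s₃), whence Pr[M = s₂] = eval s₂ / c_i(s₁, s₃).

module Submission where

open import Data.Nat as ℕ using (ℕ; zero; suc; NonZero; _*_; _≤_; _<_; z≤n; s≤s; _∸_; _≤?_; _<?_)
import Data.Nat.Properties as ℕ
open import Data.Integer as ℤ using (+_)
import Data.Integer.Properties as ℤ
open import Data.Rational using (ℚ; _/_; 0ℚ; 1ℚ; toℚᵘ) renaming (_+_ to _+ℚ_; _*_ to _*ℚ_)
import Data.Rational.Properties as ℚ
import Data.Rational.Unnormalised as ℚᵘ
import Data.Rational.Unnormalised.Properties as ℚᵘ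
import Data.Rational.Solver as ℚ-Solver
open import Algebra.Bundles using (CommutativeMonoid)
import Algebra.Properties.CommutativeSemigroup as CommSemigroupProperties
import Data.Nat.ListAction.Properties as ListAction
open import Data.Bool as Bool using (Bool; true; false; if_then_else_)
open import Data.Empty using (⊥-elim)
open import Data.Fin as Fin using (Fin; toℕ)
open import Data.Fin.Properties using (suc-injective; toℕ-injective; toℕ<n)
open import Data.List using (List; []; _∷_; _++_; map; concatMap; allFin; length; filter)
open import Data.List.Membership.Propositional.Properties using (∈-filter⁻; ∈-filter⁺; ∈-allFin; ∈-concatMap⁻)
import Data.List.Relation.Unary.Unique.Propositional.Properties as Unique
import Data.List.Properties as List
open import Data.List.Membership.Propositional using (_∈_; _∉_)
import Data.List.Relation.Unary.All as All
open import Data.List.Relation.Unary.AllPairs using (_∷_)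
open import Data.List.Relation.Unary.Unique.Propositional using (Unique)
open import Data.Vec using ([]; _∷_; lookup; _[_]≔_; replicate)
import Data.Vec.Properties as Vec
open import Data.List.Relation.Unary.Any using (here; there; satisfied)
open import Data.Nat.ListAction using (sum)
open import Data.Product using (Σ; _×_; _,_; proj₁; proj₂)
open import Function using (_∘_)
open import Relation.Nullary using (Dec; does; yes; no)
open import Relation.Nullary.Decidable using (dec-true; dec-false; _×-dec_)
open import Relation.Binary.PropositionalEquality
open import Defs

module ℕ+ = CommSemigroupProperties ℕ.+-commutativeSemigroup
module ℚ+ = CommSemigroupProperties (CommutativeMonoid.commutativeSemigroup ℚ.+-0-commutativeMonoid)
module ℕ* = CommSemigroupProperties ℕ.*-commutativeSemigroup
module ℚ* = CommSemigroupProperties (CommutativeMonoid.commutativeSemigroup ℚ.*-1-commutativeMonoid)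

-- Abstract, so that unification never unfolds ⟦ n ⟧ into the normalisation of + n / 1.
abstract
  ⟦_⟧ : ℕ → ℚ
  ⟦ n ⟧ = + n / 1

  private
    toℚᵘ-⟦⟧ : ∀ n → toℚᵘ ⟦ n ⟧ ℚᵘ.≃ ℚᵘ.mkℚᵘ (+ n) 0
    toℚᵘ-⟦⟧ n = ℚ.toℚᵘ-fromℚᵘ (ℚᵘ.mkℚᵘ (+ n) 0)

  ⟦⟧-homo-+ : ∀ m n → ⟦ m ℕ.+ n ⟧ ≡ ⟦ m ⟧ +ℚ ⟦ n ⟧
  ⟦⟧-homo-+ m n = ℚ.toℚᵘ-injective (begin
      toℚᵘ ⟦ m ℕ.+ n ⟧                                 ≈⟨ toℚᵘ-⟦⟧ (m ℕ.+ n) ⟩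
      ℚᵘ.mkℚᵘ (+ (m ℕ.+ n)) 0                          ≈⟨ ℚᵘ.*≡* (cong (ℤ._* + 1) (trans (ℤ.pos-+ m n)
                                                            (sym (cong₂ ℤ._+_ (ℤ.*-identityʳ (+ m)) (ℤ.*-identityʳ (+ n)))))) ⟩
      ℚᵘ.mkℚᵘ (+ m) 0 ℚᵘ.+ ℚᵘ.mkℚᵘ (+ n) 0              ≈⟨ ℚᵘ.+-cong (toℚᵘ-⟦⟧ m) (toℚᵘ-⟦⟧ n) ⟨
      toℚᵘ ⟦ m ⟧ ℚᵘ.+ toℚᵘ ⟦ n ⟧                        ≈⟨ ℚ.toℚᵘ-homo-+ ⟦ m ⟧ ⟦ n ⟧ ⟨
      toℚᵘ (⟦ m ⟧ +ℚ ⟦ n ⟧)                            ∎)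
    where open ℚᵘ.≃-Reasoning

  ⟦⟧-homo-* : ∀ m n → ⟦ m ℕ.* n ⟧ ≡ ⟦ m ⟧ *ℚ ⟦ n ⟧
  ⟦⟧-homo-* m n = ℚ.toℚᵘ-injective (begin
      toℚᵘ ⟦ m ℕ.* n ⟧                                 ≈⟨ toℚᵘ-⟦⟧ (m ℕ.* n) ⟩
      ℚᵘ.mkℚᵘ (+ (m ℕ.* n)) 0                          ≈⟨ ℚᵘ.*≡* (cong (ℤ._* + 1) (ℤ.pos-* m n)) ⟩
      ℚᵘ.mkℚᵘ (+ m) 0 ℚᵘ.* ℚᵘ.mkℚᵘ (+ n) 0              ≈⟨ ℚᵘ.*-cong (toℚᵘ-⟦⟧ m) (toℚᵘ-⟦⟧ n) ⟨
      toℚᵘ ⟦ m ⟧ ℚᵘ.* toℚᵘ ⟦ n ⟧                        ≈⟨ ℚ.toℚᵘ-homo-* ⟦ m ⟧ ⟦ n ⟧ ⟨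
      toℚᵘ (⟦ m ⟧ *ℚ ⟦ n ⟧)                            ∎)
    where open ℚᵘ.≃-Reasoning

  ⟦0⟧ : ⟦ 0 ⟧ ≡ 0ℚ
  ⟦0⟧ = refl

  ⟦1⟧ : ⟦ 1 ⟧ ≡ 1ℚ
  ⟦1⟧ = refl

  m/n*n≡m : ∀ m n .{{_ : NonZero n}} → (+ m / n) *ℚ ⟦ n ⟧ ≡ ⟦ m ⟧
  m/n*n≡m m n@(suc n-1) = ℚ.toℚᵘ-injective (begin
      toℚᵘ ((+ m / n) *ℚ ⟦ n ⟧)                        ≈⟨ ℚ.toℚᵘ-homo-* (+ m / n) ⟦ n ⟧ ⟩
      toℚᵘ (+ m / n) ℚᵘ.* toℚᵘ ⟦ n ⟧                    ≈⟨ ℚᵘ.*-cong (ℚ.toℚᵘ-fromℚᵘ (ℚᵘ.mkℚᵘ (+ m) n-1)) (toℚᵘ-⟦⟧ n) ⟩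
      ℚᵘ.mkℚᵘ (+ m) n-1 ℚᵘ.* ℚᵘ.mkℚᵘ (+ n) 0            ≈⟨ ℚᵘ.*≡* (trans (ℤ.*-identityʳ _)
                                                            (cong (+ m ℤ.*_) (cong +_ (sym (ℕ.*-identityʳ n))))) ⟩
      ℚᵘ.mkℚᵘ (+ m) 0                                  ≈⟨ toℚᵘ-⟦⟧ m ⟨
      toℚᵘ ⟦ m ⟧                                       ∎)
    where open ℚᵘ.≃-Reasoning

*⟦⟧-cancelʳ : ∀ n .{{_ : NonZero n}} {x y : ℚ} → x *ℚ ⟦ n ⟧ ≡ y *ℚ ⟦ n ⟧ → x ≡ y
*⟦⟧-cancelʳ n {x} {y} eq = begin
  x                                ≡⟨ undo x ⟨
  x *ℚ ⟦ n ⟧ *ℚ (+ 1 / n)          ≡⟨ cong (_*ℚ (+ 1 / n)) eq ⟩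
  y *ℚ ⟦ n ⟧ *ℚ (+ 1 / n)          ≡⟨ undo y ⟩
  y                                ∎
  where
  open ≡-Reasoning
  undo : ∀ z → z *ℚ ⟦ n ⟧ *ℚ (+ 1 / n) ≡ z
  undo z = begin
    z *ℚ ⟦ n ⟧ *ℚ (+ 1 / n)        ≡⟨ ℚ.*-assoc z ⟦ n ⟧ (+ 1 / n) ⟩
    z *ℚ (⟦ n ⟧ *ℚ (+ 1 / n))      ≡⟨ cong (z *ℚ_) (trans (ℚ.*-comm ⟦ n ⟧ (+ 1 / n)) (m/n*n≡m 1 n)) ⟩
    z *ℚ ⟦ 1 ⟧                     ≡⟨ cong (z *ℚ_) ⟦1⟧ ⟩
    z *ℚ 1ℚ                        ≡⟨ ℚ.*-identityʳ z ⟩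
    z                              ∎

*⟦⟧≡⟦⟧⇒≡/ : ∀ m n .{{_ : NonZero n}} {x : ℚ} → x *ℚ ⟦ n ⟧ ≡ ⟦ m ⟧ → x ≡ + m / n
*⟦⟧≡⟦⟧⇒≡/ m n eq = *⟦⟧-cancelʳ n (trans eq (sym (m/n*n≡m m n)))

sumℕ : ∀ {A : Set} → List A → (A → ℕ) → ℕ
sumℕ xs f = sum (map f xs)

sumℕ-++ : ∀ {A : Set} (xs ys : List A) f → sumℕ (xs ++ ys) f ≡ sumℕ xs f ℕ.+ sumℕ ys f
sumℕ-++ xs ys f = trans (cong sum (List.map-++ f xs ys)) (ListAction.sum-++ (map f xs) (map f ys))

sumℕ-concatMap : ∀ {A B : Set} (g : A → List B) xs f → sumℕ (concatMap g xs) f ≡ sumℕ xs (λ x → sumℕ (g x) f)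
sumℕ-concatMap g []       f = refl
sumℕ-concatMap g (x ∷ xs) f = trans (sumℕ-++ (g x) (concatMap g xs) f) (cong (sumℕ (g x) f ℕ.+_) (sumℕ-concatMap g xs f))

sumℕ-map : ∀ {A B : Set} (g : A → B) xs f → sumℕ (map g xs) f ≡ sumℕ xs (f ∘ g)
sumℕ-map g xs f = cong sum (sym (List.map-∘ xs))

sumℕ-cong∈ : ∀ {A : Set} (xs : List A) {f g : A → ℕ} → (∀ x → x ∈ xs → f x ≡ g x) → sumℕ xs f ≡ sumℕ xs g
sumℕ-cong∈ []       eq = refl
sumℕ-cong∈ (x ∷ xs) eq = cong₂ ℕ._+_ (eq x (here refl)) (sumℕ-cong∈ xs (λ y y∈ → eq y (there y∈)))

sumℕ-cong : ∀ {A : Set} (xs : List A) {f g : A → ℕ} → (∀ x → f x ≡ g x) → sumℕ xs f ≡ sumℕ xs g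
sumℕ-cong xs eq = sumℕ-cong∈ xs (λ x _ → eq x)

sumℕ-+ : ∀ {A : Set} (xs : List A) f g → sumℕ xs (λ x → f x ℕ.+ g x) ≡ sumℕ xs f ℕ.+ sumℕ xs g
sumℕ-+ []       f g = refl
sumℕ-+ (x ∷ xs) f g = trans (cong (f x ℕ.+ g x ℕ.+_) (sumℕ-+ xs f g)) (ℕ+.interchange (f x) (g x) _ _)

sumℕ-0 : ∀ {A : Set} (xs : List A) → sumℕ xs (λ _ → 0) ≡ 0
sumℕ-0 []       = refl
sumℕ-0 (x ∷ xs) = sumℕ-0 xs

sumℕ-*ʳ : ∀ {A : Set} (xs : List A) f m → sumℕ xs (λ x → f x ℕ.* m) ≡ sumℕ xs f ℕ.* m
sumℕ-*ʳ []       f m = refl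
sumℕ-*ʳ (x ∷ xs) f m = trans (cong (f x ℕ.* m ℕ.+_) (sumℕ-*ʳ xs f m)) (sym (ℕ.*-distribʳ-+ m (f x) _))

sumℕ-allFin-suc : ∀ n (f : Fin (suc n) → ℕ) → sumℕ (allFin (suc n)) f ≡ f Fin.zero ℕ.+ sumℕ (allFin n) (f ∘ Fin.suc)
sumℕ-allFin-suc n f = cong (λ xs → f Fin.zero ℕ.+ sum xs)
  (trans (List.map-tabulate Fin.suc f) (sym (List.map-tabulate (λ i → i) (f ∘ Fin.suc))))

[_≟_] : ∀ {n} → Fin n → Fin n → ℕ
[ i ≟ j ] = if does (i Fin.≟ j) then 1 else 0

[≟]-refl : ∀ {n} (i : Fin n) → [ i ≟ i ] ≡ 1
[≟]-refl i = cong (λ t → if t then 1 else 0) (dec-true (i Fin.≟ i) refl)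

[≟]-≢ : ∀ {n} {i j : Fin n} → i ≢ j → [ i ≟ j ] ≡ 0
[≟]-≢ {i = i} {j} i≢j = cong (λ t → if t then 1 else 0) (dec-false (i Fin.≟ j) i≢j)

sumℕ-allFin-[≟] : ∀ n (i : Fin n) (f : Fin n → ℕ) → sumℕ (allFin n) (λ j → [ i ≟ j ] ℕ.* f j) ≡ f i
sumℕ-allFin-[≟] (suc n) Fin.zero    f = begin
  sumℕ (allFin (suc n)) (λ j → [ Fin.zero ≟ j ] ℕ.* f j)      ≡⟨ sumℕ-allFin-suc n (λ j → [ Fin.zero ≟ j ] ℕ.* f j) ⟩
  f Fin.zero ℕ.+ 0 ℕ.+ sumℕ (allFin n) (λ _ → 0)              ≡⟨ cong₂ ℕ._+_ (ℕ.+-identityʳ _) (sumℕ-0 (allFin n)) ⟩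
  f Fin.zero ℕ.+ 0                                           ≡⟨ ℕ.+-identityʳ _ ⟩
  f Fin.zero                                                 ∎
  where open ≡-Reasoning
sumℕ-allFin-[≟] (suc n) (Fin.suc i) f = begin
  sumℕ (allFin (suc n)) (λ j → [ Fin.suc i ≟ j ] ℕ.* f j)              ≡⟨ sumℕ-allFin-suc n (λ j → [ Fin.suc i ≟ j ] ℕ.* f j) ⟩
  sumℕ (allFin n) (λ j → [ Fin.suc i ≟ Fin.suc j ] ℕ.* f (Fin.suc j))   ≡⟨ sumℕ-cong (allFin n) [suc≟suc] ⟩
  sumℕ (allFin n) (λ j → [ i ≟ j ] ℕ.* f (Fin.suc j))                  ≡⟨ sumℕ-allFin-[≟] n i (f ∘ Fin.suc) ⟩
  f (Fin.suc i)                                                       ∎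
  where
  open ≡-Reasoning
  [suc≟suc] : ∀ j → [ Fin.suc i ≟ Fin.suc j ] ℕ.* f (Fin.suc j) ≡ [ i ≟ j ] ℕ.* f (Fin.suc j)
  [suc≟suc] j with i Fin.≟ j
  ... | yes _ = refl
  ... | no  _ = refl

occurrences : ∀ {n} → Fin n → List (Fin n) → ℕ
occurrences v us = sumℕ us (λ u → [ u ≟ v ])

sumℕ-allFin-occurrences : ∀ {n} (us : List (Fin n)) (g : Fin n → ℕ) → sumℕ (allFin n) (λ p → occurrences p us ℕ.* g p) ≡ sumℕ us g
sumℕ-allFin-occurrences {n} []       g = sumℕ-0 (allFin n)
sumℕ-allFin-occurrences {n} (u ∷ us) g = begin
  sumℕ (allFin n) (λ p → ([ u ≟ p ] ℕ.+ occurrences p us) ℕ.* g p)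
    ≡⟨ sumℕ-cong (allFin n) (λ p → ℕ.*-distribʳ-+ (g p) [ u ≟ p ] (occurrences p us)) ⟩
  sumℕ (allFin n) (λ p → [ u ≟ p ] ℕ.* g p ℕ.+ occurrences p us ℕ.* g p)
    ≡⟨ sumℕ-+ (allFin n) (λ p → [ u ≟ p ] ℕ.* g p) (λ p → occurrences p us ℕ.* g p) ⟩
  sumℕ (allFin n) (λ p → [ u ≟ p ] ℕ.* g p) ℕ.+ sumℕ (allFin n) (λ p → occurrences p us ℕ.* g p)
    ≡⟨ cong₂ ℕ._+_ (sumℕ-allFin-[≟] n u g) (sumℕ-allFin-occurrences us g) ⟩
  g u ℕ.+ sumℕ us g
    ∎
  where open ≡-Reasoning

sumℚ : ∀ {A : Set} → List A → (A → ℚ) → ℚ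
sumℚ []       f = 0ℚ
sumℚ (x ∷ xs) f = f x +ℚ sumℚ xs f

sumℚ-cong∈ : ∀ {A : Set} (xs : List A) {f g : A → ℚ} → (∀ x → x ∈ xs → f x ≡ g x) → sumℚ xs f ≡ sumℚ xs g
sumℚ-cong∈ []       eq = refl
sumℚ-cong∈ (x ∷ xs) eq = cong₂ _+ℚ_ (eq x (here refl)) (sumℚ-cong∈ xs (λ y y∈ → eq y (there y∈)))

sumℚ-cong : ∀ {A : Set} (xs : List A) {f g : A → ℚ} → (∀ x → f x ≡ g x) → sumℚ xs f ≡ sumℚ xs g
sumℚ-cong xs eq = sumℚ-cong∈ xs (λ x _ → eq x)

sumℚ-++ : ∀ {A : Set} (xs ys : List A) f → sumℚ (xs ++ ys) f ≡ sumℚ xs f +ℚ sumℚ ys f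
sumℚ-++ []       ys f = sym (ℚ.+-identityˡ _)
sumℚ-++ (x ∷ xs) ys f = trans (cong (f x +ℚ_) (sumℚ-++ xs ys f)) (sym (ℚ.+-assoc (f x) _ _))

sumℚ-concatMap : ∀ {A B : Set} (g : A → List B) xs f → sumℚ (concatMap g xs) f ≡ sumℚ xs (λ x → sumℚ (g x) f)
sumℚ-concatMap g []       f = refl
sumℚ-concatMap g (x ∷ xs) f = trans (sumℚ-++ (g x) (concatMap g xs) f) (cong (sumℚ (g x) f +ℚ_) (sumℚ-concatMap g xs f))

sumℚ-map : ∀ {A B : Set} (g : A → B) xs f → sumℚ (map g xs) f ≡ sumℚ xs (f ∘ g)
sumℚ-map g []       f = refl
sumℚ-map g (x ∷ xs) f = cong (f (g x) +ℚ_) (sumℚ-map g xs f)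

sumℚ-+ : ∀ {A : Set} (xs : List A) f g → sumℚ xs (λ x → f x +ℚ g x) ≡ sumℚ xs f +ℚ sumℚ xs g
sumℚ-+ []       f g = refl
sumℚ-+ (x ∷ xs) f g = trans (cong (f x +ℚ g x +ℚ_) (sumℚ-+ xs f g)) (ℚ+.interchange (f x) (g x) _ _)

sumℚ-*ˡ : ∀ {A : Set} (xs : List A) f r → sumℚ xs (λ x → r *ℚ f x) ≡ r *ℚ sumℚ xs f
sumℚ-*ˡ []       f r = sym (ℚ.*-zeroʳ r)
sumℚ-*ˡ (x ∷ xs) f r = trans (cong (r *ℚ f x +ℚ_) (sumℚ-*ˡ xs f r)) (sym (ℚ.*-distribˡ-+ r (f x) _))

sumℚ-*ʳ : ∀ {A : Set} (xs : List A) f r → sumℚ xs (λ x → f x *ℚ r) ≡ sumℚ xs f *ℚ r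
sumℚ-*ʳ xs f r = trans (sumℚ-cong xs (λ x → ℚ.*-comm (f x) r)) (trans (sumℚ-*ˡ xs f r) (ℚ.*-comm r _))

sumℚ-swap : ∀ {A B : Set} (xs : List A) (ys : List B) (f : A → B → ℚ) → sumℚ xs (λ x → sumℚ ys (f x)) ≡ sumℚ ys (λ y → sumℚ xs (λ x → f x y))
sumℚ-swap []       ys f = sym (sumℚ-0 ys)
  where
  sumℚ-0 : ∀ {B : Set} (ys : List B) → sumℚ ys (λ _ → 0ℚ) ≡ 0ℚ
  sumℚ-0 []       = refl
  sumℚ-0 (y ∷ ys) = trans (ℚ.+-identityˡ _) (sumℚ-0 ys)
sumℚ-swap (x ∷ xs) ys f = trans (cong (sumℚ ys (f x) +ℚ_) (sumℚ-swap xs ys f)) (sym (sumℚ-+ ys (f x) (λ y → sumℚ xs (λ x′ → f x′ y))))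

⟦⟧-sumℕ : ∀ {A : Set} (xs : List A) f → ⟦ sumℕ xs f ⟧ ≡ sumℚ xs (λ x → ⟦ f x ⟧)
⟦⟧-sumℕ []       f = ⟦0⟧
⟦⟧-sumℕ (x ∷ xs) f = trans (⟦⟧-homo-+ (f x) _) (cong (⟦ f x ⟧ +ℚ_) (⟦⟧-sumℕ xs f))

weigh : ∀ {A : Set} → (A → ℚ) → A × ℚ → ℚ
weigh g (a , q) = q *ℚ g a

𝔼 : ∀ {A : Set} → Dist A → (A → ℚ) → ℚ
𝔼 d g = sumℚ d (weigh g)

𝔼-cong : ∀ {A : Set} (d : Dist A) {g h : A → ℚ} → (∀ a → g a ≡ h a) → 𝔼 d g ≡ 𝔼 d h
𝔼-cong d eq = sumℚ-cong d (λ aq → cong (proj₂ aq *ℚ_) (eq (proj₁ aq)))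

𝔼-return : ∀ {A : Set} (a : A) g → 𝔼 (return a) g ≡ g a
𝔼-return a g = trans (ℚ.+-identityʳ _) (ℚ.*-identityˡ _)

𝔼-bind : ∀ {A B : Set} (d : Dist A) (f : A → Dist B) g → 𝔼 (d >>= f) g ≡ 𝔼 d (λ a → 𝔼 (f a) g)
𝔼-bind d f g = trans (sumℚ-concatMap _ d (weigh g)) (sumℚ-cong d (λ aq → begin
  sumℚ (map (λ bq → proj₁ bq , proj₂ aq *ℚ proj₂ bq) (f (proj₁ aq))) (weigh g)
    ≡⟨ sumℚ-map _ (f (proj₁ aq)) (weigh g) ⟩
  sumℚ (f (proj₁ aq)) (λ bq → proj₂ aq *ℚ proj₂ bq *ℚ g (proj₁ bq))
    ≡⟨ sumℚ-cong (f (proj₁ aq)) (λ bq → ℚ.*-assoc (proj₂ aq) (proj₂ bq) _) ⟩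
  sumℚ (f (proj₁ aq)) (λ bq → proj₂ aq *ℚ weigh g bq)
    ≡⟨ sumℚ-*ˡ (f (proj₁ aq)) (weigh g) (proj₂ aq) ⟩
  proj₂ aq *ℚ 𝔼 (f (proj₁ aq)) g
    ∎))
  where open ≡-Reasoning

𝔼-*ʳ : ∀ {A : Set} (d : Dist A) g r → 𝔼 d (λ a → g a *ℚ r) ≡ 𝔼 d g *ℚ r
𝔼-*ʳ d g r = trans (sumℚ-cong d (λ aq → sym (ℚ.*-assoc (proj₂ aq) _ r))) (sumℚ-*ʳ d (weigh g) r)

sumℚ-𝔼 : ∀ {A B : Set} (xs : List A) (d : Dist B) (f : A → B → ℚ) →
  sumℚ xs (λ x → 𝔼 d (f x)) ≡ 𝔼 d (λ b → sumℚ xs (λ x → f x b))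
sumℚ-𝔼 xs d f = trans (sumℚ-swap xs d (λ x → weigh (f x)))
  (sumℚ-cong d (λ bq → sumℚ-*ˡ xs (λ x → f x (proj₁ bq)) (proj₂ bq)))

Pr≡𝔼 : ∀ {A : Set} (d : Dist A) P P? → Pr d P P? ≡ 𝔼 d (λ a → if does (P? a) then 1ℚ else 0ℚ)
Pr≡𝔼 []            P P? = refl
Pr≡𝔼 ((a , q) ∷ d) P P? = cong₂ _+ℚ_ (weigh-indicator (does (P? a))) (Pr≡𝔼 d P P?)
  where
  weigh-indicator : ∀ b → (if b then q else 0ℚ) ≡ q *ℚ (if b then 1ℚ else 0ℚ)
  weigh-indicator true  = sym (ℚ.*-identityʳ q)
  weigh-indicator false = sym (ℚ.*-zeroʳ q)

𝔼-choose : ∀ {A : Set} (xs : List (A × ℕ)) g →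
  𝔼 (choose xs) g *ℚ ⟦ sumℕ xs proj₂ ⟧ ≡ sumℚ xs (λ aw → ⟦ proj₂ aw ⟧ *ℚ g (proj₁ aw))
𝔼-choose xs g with sumℕ xs proj₂ in total
... | zero  = trans (ℚ.*-zeroˡ ⟦ 0 ⟧) (sym (weightless xs total))
  where
  weightless : ∀ ys → sumℕ ys proj₂ ≡ 0 → sumℚ ys (λ aw → ⟦ proj₂ aw ⟧ *ℚ g (proj₁ aw)) ≡ 0ℚ
  weightless []             _  = refl
  weightless ((a , w) ∷ ys) eq = cong₂ _+ℚ_
    (trans (cong (λ m → ⟦ m ⟧ *ℚ g a) (ℕ.m+n≡0⇒m≡0 w eq)) (trans (cong (_*ℚ g a) ⟦0⟧) (ℚ.*-zeroˡ (g a))))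
    (weightless ys (ℕ.m+n≡0⇒n≡0 w eq))
... | suc t = begin
  𝔼 (map (λ aw → proj₁ aw , + proj₂ aw / suc t) xs) g *ℚ ⟦ suc t ⟧
    ≡⟨ cong (_*ℚ ⟦ suc t ⟧) (sumℚ-map _ xs (weigh g)) ⟩
  sumℚ xs (λ aw → (+ proj₂ aw / suc t) *ℚ g (proj₁ aw)) *ℚ ⟦ suc t ⟧
    ≡⟨ sumℚ-*ʳ xs _ ⟦ suc t ⟧ ⟨
  sumℚ xs (λ aw → (+ proj₂ aw / suc t) *ℚ g (proj₁ aw) *ℚ ⟦ suc t ⟧)
    ≡⟨ sumℚ-cong xs (λ aw → trans (ℚ*.xy∙z≈xz∙y (+ proj₂ aw / suc t) (g (proj₁ aw)) ⟦ suc t ⟧)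
                                  (cong (_*ℚ g (proj₁ aw)) (m/n*n≡m (proj₂ aw) (suc t)))) ⟩
  sumℚ xs (λ aw → ⟦ proj₂ aw ⟧ *ℚ g (proj₁ aw))
    ∎
  where open ≡-Reasoning

𝔼-coin : ∀ h → 𝔼 coin h *ℚ ⟦ 2 ⟧ ≡ h false +ℚ h true
𝔼-coin h = begin
  𝔼 coin h *ℚ ⟦ 2 ⟧                                  ≡⟨ 𝔼-choose ((false , 1) ∷ (true , 1) ∷ []) h ⟩
  ⟦ 1 ⟧ *ℚ h false +ℚ (⟦ 1 ⟧ *ℚ h true +ℚ 0ℚ)          ≡⟨ cong₂ _+ℚ_ (one* (h false)) (trans (ℚ.+-identityʳ _) (one* (h true))) ⟩
  h false +ℚ h true                                  ∎
  where
  open ≡-Reasoning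
  one* : ∀ x → ⟦ 1 ⟧ *ℚ x ≡ x
  one* x = trans (cong (_*ℚ x) ⟦1⟧) (ℚ.*-identityˡ x)

prodFin : ∀ n → (Fin n → ℕ) → ℕ
prodFin zero    f = 1
prodFin (suc n) f = f Fin.zero ℕ.* prodFin n (f ∘ Fin.suc)

prodFin-cong : ∀ n {f g : Fin n → ℕ} → (∀ i → f i ≡ g i) → prodFin n f ≡ prodFin n g
prodFin-cong zero    eq = refl
prodFin-cong (suc n) eq = cong₂ ℕ._*_ (eq Fin.zero) (prodFin-cong n (eq ∘ Fin.suc))

prodFin-extract : ∀ n (f g : Fin n → ℕ) j → (∀ i → i ≢ j → f i ≡ g i) → g j ≡ 1 →
  prodFin n f ≡ f j ℕ.* prodFin n g
prodFin-extract (suc n) f g Fin.zero    f≡g g0≡1 =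
  cong (f Fin.zero ℕ.*_) (trans (prodFin-cong n (λ i → f≡g (Fin.suc i) λ ()))
                                (sym (trans (cong (ℕ._* prodFin n (g ∘ Fin.suc)) g0≡1) (ℕ.*-identityˡ _))))
prodFin-extract (suc n) f g (Fin.suc j) f≡g gj≡1 = begin
  f Fin.zero ℕ.* prodFin n (f ∘ Fin.suc)                         ≡⟨ cong (f Fin.zero ℕ.*_) (prodFin-extract n (f ∘ Fin.suc) (g ∘ Fin.suc) j
                                                                       (λ i i≢j → f≡g (Fin.suc i) (i≢j ∘ suc-injective)) gj≡1) ⟩
  f Fin.zero ℕ.* (f (Fin.suc j) ℕ.* prodFin n (g ∘ Fin.suc))     ≡⟨ ℕ*.x∙yz≈y∙xz (f Fin.zero) (f (Fin.suc j)) (prodFin n (g ∘ Fin.suc)) ⟩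
  f (Fin.suc j) ℕ.* (f Fin.zero ℕ.* prodFin n (g ∘ Fin.suc))     ≡⟨ cong (λ x → f (Fin.suc j) ℕ.* (x ℕ.* _)) (f≡g Fin.zero λ ()) ⟩
  f (Fin.suc j) ℕ.* prodFin (suc n) g                            ∎
  where open ≡-Reasoning

prodFin-1 : ∀ n → prodFin n (λ _ → 1) ≡ 1
prodFin-1 zero    = refl
prodFin-1 (suc n) = trans (ℕ.+-identityʳ _) (prodFin-1 n)

agreeBit : Bool → Bool → ℕ
agreeBit a b = if does (a Bool.≟ b) then 1 else 0

agreeBit-sumʳ : ∀ a → agreeBit a false ℕ.+ agreeBit a true ≡ 1
agreeBit-sumʳ false = refl
agreeBit-sumʳ true  = refl

agreeBit-sumˡ : ∀ b → agreeBit false b ℕ.+ agreeBit true b ≡ 1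
agreeBit-sumˡ false = refl
agreeBit-sumˡ true  = refl

Mask : ℕ → Set
Mask k = Fin k → Bool

allTrue : ∀ {k} → Mask k
allTrue _ = true

agree : ∀ {k} → Mask k → State k → State k → ℕ
agree {k} M s ω = prodFin k (λ j → if M j then agreeBit (lookup s j) (lookup ω j) else 1)

agree-cong : ∀ {k} {M M′ : Mask k} (s ω : State k) → (∀ j → M j ≡ M′ j) → agree M s ω ≡ agree M′ s ω
agree-cong {k} s ω eq = prodFin-cong k (λ j → cong (λ b → if b then agreeBit (lookup s j) (lookup ω j) else 1) (eq j))

agree-update : ∀ {k} (M M′ : Mask k) (s ω : State k) j b → M j ≡ true → M′ j ≡ false → (∀ i → i ≢ j → M′ i ≡ M i) →
  agree M s (ω [ j ]≔ b) ≡ agreeBit (lookup s j) b ℕ.* agree M′ s ω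
agree-update {k} M M′ s ω j b Mj M′j M′≡M = begin
  agree M s (ω [ j ]≔ b)
    ≡⟨ prodFin-extract k _ _ j same-off-j (cong (λ c → if c then _ else 1) M′j) ⟩
  (if M j then agreeBit (lookup s j) (lookup (ω [ j ]≔ b) j) else 1) ℕ.* agree M′ s ω
    ≡⟨ cong (λ c → (if c then _ else 1) ℕ.* agree M′ s ω) Mj ⟩
  agreeBit (lookup s j) (lookup (ω [ j ]≔ b) j) ℕ.* agree M′ s ω
    ≡⟨ cong (λ x → agreeBit (lookup s j) x ℕ.* agree M′ s ω) (Vec.lookup∘update j ω b) ⟩
  agreeBit (lookup s j) b ℕ.* agree M′ s ω
    ∎
  where
  open ≡-Reasoning
  same-off-j : ∀ i → i ≢ j → (if M i then agreeBit (lookup s i) (lookup (ω [ j ]≔ b) i) else 1)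
                           ≡ (if M′ i then agreeBit (lookup s i) (lookup ω i) else 1)
  same-off-j i i≢j rewrite Vec.lookup∘update′ i≢j ω b | M′≡M i i≢j = refl

agree-self : ∀ {k} (s : State k) → agree allTrue s s ≡ 1
agree-self []       = refl
agree-self (b ∷ s) = trans (cong (λ t → (if t then 1 else 0) ℕ.* agree allTrue s s) (dec-true (b Bool.≟ b) refl))
                           (trans (ℕ.*-identityˡ _) (agree-self s))

agree-≢ : ∀ {k} (s ω : State k) → ω ≢ s → agree allTrue s ω ≡ 0
agree-≢ []      []      ω≢s = ⊥-elim (ω≢s refl)
agree-≢ (b ∷ s) (a ∷ ω) ω≢s with b Bool.≟ a
... | yes refl = trans (cong (1 ℕ.*_) (agree-≢ s ω (ω≢s ∘ cong (a ∷_)))) (ℕ.*-zeroʳ 1)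
... | no  _    = refl

indicator≡agree : ∀ {k} (s ω : State k) → (if does (ω ≟S s) then 1ℚ else 0ℚ) ≡ ⟦ agree allTrue s ω ⟧
indicator≡agree s ω with ω ≟S s
... | yes refl = trans (sym ⟦1⟧) (cong ⟦_⟧ (sym (agree-self ω)))
... | no  ω≢s  = trans (sym ⟦0⟧) (cong ⟦_⟧ (sym (agree-≢ s ω ω≢s)))

sumℕ-allStates-agree : ∀ k (ω : State k) → sumℕ (allStates k) (λ s → agree allTrue s ω) ≡ 1
sumℕ-allStates-agree zero    []      = refl
sumℕ-allStates-agree (suc k) (a ∷ ω) = begin
  sumℕ (allStates (suc k)) (λ s → agree allTrue s (a ∷ ω))
    ≡⟨ sumℕ-concatMap (λ s → (false ∷ s) ∷ (true ∷ s) ∷ []) (allStates k) (λ s → agree allTrue s (a ∷ ω)) ⟩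
  sumℕ (allStates k) (λ s → agreeBit false a ℕ.* agree allTrue s ω ℕ.+ (agreeBit true a ℕ.* agree allTrue s ω ℕ.+ 0))
    ≡⟨ sumℕ-cong (allStates k) (λ s → trans (cong (agreeBit false a ℕ.* agree allTrue s ω ℕ.+_) (ℕ.+-identityʳ _))
                                            (trans (sym (ℕ.*-distribʳ-+ (agree allTrue s ω) (agreeBit false a) (agreeBit true a)))
                                                   (trans (cong (ℕ._* agree allTrue s ω) (agreeBit-sumˡ a)) (ℕ.*-identityˡ _)))) ⟩
  sumℕ (allStates k) (λ s → agree allTrue s ω)
    ≡⟨ sumℕ-allStates-agree k ω ⟩
  1
    ∎
  where open ≡-Reasoning

𝔼-uniformBits-agree : ∀ {k} (s : State k) (js : List (Fin k)) (ω : State k) (M M′ : Mask k) → Unique js →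
  (∀ i → i ∈ js → M i ≡ true) → (∀ i → i ∈ js → M′ i ≡ false) → (∀ i → i ∉ js → M′ i ≡ M i) →
  𝔼 (uniformBits js ω) (λ ω′ → ⟦ agree M s ω′ ⟧) *ℚ ⟦ 2 ℕ.^ length js ⟧ ≡ ⟦ agree M′ s ω ⟧
𝔼-uniformBits-agree s []       ω M M′ _ _ _ M′≡M = begin
  𝔼 (return ω) (λ ω′ → ⟦ agree M s ω′ ⟧) *ℚ ⟦ 1 ⟧    ≡⟨ cong₂ _*ℚ_ (𝔼-return ω (λ ω′ → ⟦ agree M s ω′ ⟧)) ⟦1⟧ ⟩
  ⟦ agree M s ω ⟧ *ℚ 1ℚ                            ≡⟨ ℚ.*-identityʳ _ ⟩
  ⟦ agree M s ω ⟧                                  ≡⟨ cong ⟦_⟧ (agree-cong s ω (λ j → sym (M′≡M j λ ()))) ⟩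
  ⟦ agree M′ s ω ⟧                                 ∎
  where open ≡-Reasoning
𝔼-uniformBits-agree {k} s (j ∷ js) ω M M′ (j∉js ∷ js-unique) M-on M′-on M′-off = begin
  𝔼 (coin >>= λ b → uniformBits js (ω [ j ]≔ b)) g *ℚ ⟦ 2 ℕ.* 2 ℕ.^ length js ⟧
    ≡⟨ cong₂ _*ℚ_ (𝔼-bind coin (λ b → uniformBits js (ω [ j ]≔ b)) g) (⟦⟧-homo-* 2 (2 ℕ.^ length js)) ⟩
  𝔼 coin X *ℚ (⟦ 2 ⟧ *ℚ T)
    ≡⟨ ℚ*.xy∙z≈x∙zy (𝔼 coin X) T ⟦ 2 ⟧ ⟨
  𝔼 coin X *ℚ T *ℚ ⟦ 2 ⟧
    ≡⟨ cong (_*ℚ ⟦ 2 ⟧) (𝔼-*ʳ coin X T) ⟨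
  𝔼 coin (λ b → X b *ℚ T) *ℚ ⟦ 2 ⟧
    ≡⟨ 𝔼-coin (λ b → X b *ℚ T) ⟩
  X false *ℚ T +ℚ X true *ℚ T
    ≡⟨ cong₂ _+ℚ_ (randomised false) (randomised true) ⟩
  ⟦ agreeBit (lookup s j) false ℕ.* agree M′ s ω ⟧ +ℚ ⟦ agreeBit (lookup s j) true ℕ.* agree M′ s ω ⟧
    ≡⟨ ⟦⟧-homo-+ _ _ ⟨
  ⟦ agreeBit (lookup s j) false ℕ.* agree M′ s ω ℕ.+ agreeBit (lookup s j) true ℕ.* agree M′ s ω ⟧
    ≡⟨ cong ⟦_⟧ (trans (sym (ℕ.*-distribʳ-+ (agree M′ s ω) (agreeBit (lookup s j) false) (agreeBit (lookup s j) true)))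
                       (trans (cong (ℕ._* agree M′ s ω) (agreeBit-sumʳ (lookup s j))) (ℕ.*-identityˡ _))) ⟩
  ⟦ agree M′ s ω ⟧
    ∎
  where
  open ≡-Reasoning
  g : State k → ℚ
  g ω′ = ⟦ agree M s ω′ ⟧
  T : ℚ
  T = ⟦ 2 ℕ.^ length js ⟧
  X : Bool → ℚ
  X b = 𝔼 (uniformBits js (ω [ j ]≔ b)) g
  M″ : Mask k
  M″ i = if does (i Fin.≟ j) then true else M′ i
  M″-on : ∀ i → i ∈ js → M″ i ≡ false
  M″-on i i∈js with i Fin.≟ j
  ... | yes refl = ⊥-elim (All.lookup j∉js i∈js refl)
  ... | no  _    = M′-on i (there i∈js)
  M″-off : ∀ i → i ∉ js → M″ i ≡ M i
  M″-off i i∉js with i Fin.≟ j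
  ... | yes refl = sym (M-on j (here refl))
  ... | no  i≢j  = M′-off i λ { (here i≡j) → i≢j i≡j ; (there i∈js) → i∉js i∈js }
  M″-j : M″ j ≡ true
  M″-j rewrite dec-true (j Fin.≟ j) refl = refl
  M″-off-j : ∀ i → i ≢ j → M′ i ≡ M″ i
  M″-off-j i i≢j rewrite dec-false (i Fin.≟ j) i≢j = refl
  randomised : ∀ b → X b *ℚ T ≡ ⟦ agreeBit (lookup s j) b ℕ.* agree M′ s ω ⟧
  randomised b = trans (𝔼-uniformBits-agree s js (ω [ j ]≔ b) M M″ js-unique (λ i → M-on i ∘ there) M″-on M″-off)
                       (cong ⟦_⟧ (agree-update M″ M′ s ω j b M″-j (M′-on j (here refl)) M″-off-j))

𝔼-uniformBits-1 : ∀ {k} (js : List (Fin k)) ω → 𝔼 (uniformBits js ω) (λ _ → 1ℚ) ≡ 1ℚ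
𝔼-uniformBits-1 []       ω = 𝔼-return ω (λ _ → 1ℚ)
𝔼-uniformBits-1 (j ∷ js) ω = trans (𝔼-bind coin (λ b → uniformBits js (ω [ j ]≔ b)) (λ _ → 1ℚ))
  (trans (𝔼-cong coin (λ b → 𝔼-uniformBits-1 js (ω [ j ]≔ b))) refl)

𝔼-uniformBits-const : ∀ {k} (js : List (Fin k)) ω r → 𝔼 (uniformBits js ω) (λ _ → r) ≡ r
𝔼-uniformBits-const js ω r = begin
  𝔼 (uniformBits js ω) (λ _ → r)              ≡⟨ 𝔼-cong (uniformBits js ω) (λ _ → sym (ℚ.*-identityˡ r)) ⟩
  𝔼 (uniformBits js ω) (λ _ → 1ℚ *ℚ r)        ≡⟨ 𝔼-*ʳ (uniformBits js ω) (λ _ → 1ℚ) r ⟩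
  𝔼 (uniformBits js ω) (λ _ → 1ℚ) *ℚ r        ≡⟨ cong (_*ℚ r) (𝔼-uniformBits-1 js ω) ⟩
  1ℚ *ℚ r                                     ≡⟨ ℚ.*-identityˡ r ⟩
  r                                           ∎
  where open ≡-Reasoning

length-filter≡sumℕ : ∀ {A : Set} {P : A → Set} (P? : ∀ x → Dec (P x)) xs →
  length (filter P? xs) ≡ sumℕ xs (λ x → if does (P? x) then 1 else 0)
length-filter≡sumℕ P? []       = refl
length-filter≡sumℕ P? (x ∷ xs) with does (P? x)
... | true  = cong suc (length-filter≡sumℕ P? xs)
... | false = length-filter≡sumℕ P? xs

between : ℕ → ℕ → ℕ → ℕ
between a b m = if does ((a <? m) ×-dec (m <? b)) then 1 else 0

countBetween : ℕ → ℕ → ℕ → ℕ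
countBetween a b zero    = 0
countBetween a b (suc k) = between a b (suc k) ℕ.+ countBetween a b k

countBetween-below : ∀ a b k → k < b → countBetween a b k ≡ k ∸ a
countBetween-below a b zero    _   = sym (ℕ.0∸n≡0 a)
countBetween-below a b (suc k) k<b with a <? suc k
... | yes a<k+1 = begin
  between a b (suc k) ℕ.+ countBetween a b k  ≡⟨ cong₂ ℕ._+_ (cong (λ t → if t then 1 else 0) (dec-true ((a <? suc k) ×-dec (suc k <? b)) (a<k+1 , k<b)))
                                                          (countBetween-below a b k (ℕ.<-trans (ℕ.n<1+n k) k<b)) ⟩
  1 ℕ.+ (k ∸ a)                               ≡⟨ ℕ.+-∸-assoc 1 (ℕ.≤-pred a<k+1) ⟨
  suc k ∸ a                                   ∎
  where open ≡-Reasoning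
... | no a≮k+1 = begin
  between a b (suc k) ℕ.+ countBetween a b k  ≡⟨ cong₂ ℕ._+_ (cong (λ t → if t then 1 else 0) (dec-false ((a <? suc k) ×-dec (suc k <? b)) (a≮k+1 ∘ proj₁)))
                                                          (countBetween-below a b k (ℕ.<-trans (ℕ.n<1+n k) k<b)) ⟩
  k ∸ a                                       ≡⟨ ℕ.m≤n⇒m∸n≡0 (ℕ.≤-trans (ℕ.n≤1+n k) (ℕ.≮⇒≥ a≮k+1)) ⟩
  0                                           ≡⟨ ℕ.m≤n⇒m∸n≡0 (ℕ.≮⇒≥ a≮k+1) ⟨
  suc k ∸ a                                   ∎
  where open ≡-Reasoning

countBetween-upTo : ∀ a b k → b ≤ suc k → countBetween a b k ≡ b ∸ suc a
countBetween-upTo a b zero    b≤1 = sym (ℕ.m≤n⇒m∸n≡0 (ℕ.≤-trans b≤1 (s≤s z≤n)))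
countBetween-upTo a b (suc k) b≤k+2 with b ≤? suc k
... | yes b≤k+1 = cong₂ ℕ._+_ (cong (λ t → if t then 1 else 0) (dec-false ((a <? suc k) ×-dec (suc k <? b)) (ℕ.≤⇒≯ b≤k+1 ∘ proj₂)))
                              (countBetween-upTo a b k b≤k+1)
... | no b≰k+1 with ℕ.≤-antisym b≤k+2 (ℕ.≰⇒> b≰k+1)
... | refl = countBetween-below a (suc (suc k)) (suc k) (ℕ.n<1+n (suc k))

varLevel : ∀ {k} → Fin k → ℕ
varLevel {k} x = k ∸ toℕ x

length-skipped : ∀ k a b → b ≤ suc k → length (skipped k a b) ≡ b ∸ a ∸ 1
length-skipped k a b b≤k+1 = begin
  length (skipped k a b)                             ≡⟨ length-filter≡sumℕ _ (allFin k) ⟩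
  sumℕ (allFin k) (λ j → between a b (varLevel j))   ≡⟨ sum-between k ⟩
  countBetween a b k                                 ≡⟨ countBetween-upTo a b k b≤k+1 ⟩
  b ∸ suc a                                          ≡⟨ cong (b ∸_) (ℕ.+-comm 1 a) ⟩
  b ∸ (a ℕ.+ 1)                                      ≡⟨ ℕ.∸-+-assoc b a 1 ⟨
  b ∸ a ∸ 1                                          ∎
  where
  open ≡-Reasoning
  sum-between : ∀ k → sumℕ (allFin k) (λ j → between a b (varLevel j)) ≡ countBetween a b k
  sum-between zero    = refl
  sum-between (suc k) = trans (sumℕ-allFin-suc k (λ j → between a b (varLevel j))) (cong (between a b (suc k) ℕ.+_) (sum-between k))

skipped⁻ : ∀ {k a b} {j : Fin k} → j ∈ skipped k a b → a < varLevel j × varLevel j < b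
skipped⁻ {k} {a} {b} = proj₂ ∘ ∈-filter⁻ (λ j → (a <? varLevel j) ×-dec (varLevel j <? b)) {xs = allFin k}

skipped⁺ : ∀ {k a b} {j : Fin k} → a < varLevel j → varLevel j < b → j ∈ skipped k a b
skipped⁺ {k} {a} {b} {j} a<j j<b = ∈-filter⁺ (λ j → (a <? varLevel j) ×-dec (varLevel j <? b)) (∈-allFin j) (a<j , j<b)

skipped-unique : ∀ k a b → Unique (skipped k a b)
skipped-unique k a b = Unique.filter⁺ (λ j → (a <? varLevel j) ×-dec (varLevel j <? b)) (Unique.allFin⁺ k)

varLevel-injective : ∀ {k} {i j : Fin k} → varLevel i ≡ varLevel j → i ≡ j
varLevel-injective {i = i} {j} eq = toℕ-injective (ℕ.∸-cancelˡ-≡ (ℕ.<⇒≤ (toℕ<n i)) (ℕ.<⇒≤ (toℕ<n j)) eq)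

varLevel≤k : ∀ {k} (j : Fin k) → varLevel j ≤ k
varLevel≤k {k} j = ℕ.m∸n≤m k (toℕ j)

lowerMask : ∀ {k} → ℕ → Mask k
lowerMask L j = does (varLevel j ≤? L)

agree-lowerMask-0 : ∀ {k} (s ω : State k) → agree (lowerMask 0) s ω ≡ 1
agree-lowerMask-0 {k} s ω = trans
  (prodFin-cong k (λ j → cong (λ t → if t then agreeBit (lookup s j) (lookup ω j) else 1)
                              (dec-false (varLevel j ≤? 0) (ℕ.<⇒≱ (ℕ.m<n⇒0<n∸m (toℕ<n j))))))
  (prodFin-1 k)

𝔼-uniformBits-above : ∀ {k} (s ω : State k) L →
  𝔼 (uniformBits (skipped k L (suc k)) ω) (λ ω′ → ⟦ agree allTrue s ω′ ⟧) *ℚ ⟦ 2 ℕ.^ (k ∸ L) ⟧ ≡ ⟦ agree (lowerMask L) s ω ⟧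
𝔼-uniformBits-above {k} s ω L = trans
  (cong (λ m → 𝔼 (uniformBits js ω) (λ ω′ → ⟦ agree allTrue s ω′ ⟧) *ℚ ⟦ 2 ℕ.^ m ⟧) (sym length-js))
  (𝔼-uniformBits-agree s js ω allTrue (lowerMask L) (skipped-unique k L (suc k)) (λ _ _ → refl) on off)
  where
  js = skipped k L (suc k)
  length-js : length js ≡ k ∸ L
  length-js = trans (length-skipped k L (suc k) ℕ.≤-refl)
                    (trans (ℕ.∸-+-assoc (suc k) L 1) (cong (suc k ∸_) (ℕ.+-comm L 1)))
  on : ∀ i → i ∈ js → lowerMask L i ≡ false
  on i i∈js = dec-false (varLevel i ≤? L) (ℕ.<⇒≱ (proj₁ (skipped⁻ i∈js)))
  off : ∀ i → i ∉ js → lowerMask L i ≡ true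
  off i i∉js with L <? varLevel i
  ... | yes L<i = ⊥-elim (i∉js (skipped⁺ L<i (s≤s (varLevel≤k i))))
  ... | no  L≮i = dec-true (varLevel i ≤? L) (ℕ.≮⇒≥ L≮i)

𝔼-uniformBits-between : ∀ {k} (s ω : State k) x b {lv lp} → lv < lp → varLevel x ≡ lp →
  𝔼 (uniformBits (skipped k lv lp) (ω [ x ]≔ b)) (λ ω′ → ⟦ agree (lowerMask lp) s ω′ ⟧) *ℚ ⟦ 2 ℕ.^ (lp ∸ lv ∸ 1) ⟧
    ≡ ⟦ agreeBit (lookup s x) b ℕ.* agree (lowerMask lv) s ω ⟧
𝔼-uniformBits-between {k} s ω x b {lv} {lp} lv<lp x-at-lp = begin
  𝔼 (uniformBits js (ω [ x ]≔ b)) (λ ω′ → ⟦ agree (lowerMask lp) s ω′ ⟧) *ℚ ⟦ 2 ℕ.^ (lp ∸ lv ∸ 1) ⟧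
    ≡⟨ cong (λ m → 𝔼 (uniformBits js (ω [ x ]≔ b)) (λ ω′ → ⟦ agree (lowerMask lp) s ω′ ⟧) *ℚ ⟦ 2 ℕ.^ m ⟧)
            (sym (length-skipped k lv lp (ℕ.≤-trans (ℕ.≤-reflexive (sym x-at-lp)) (ℕ.≤-trans (varLevel≤k x) (ℕ.n≤1+n k))))) ⟩
  𝔼 (uniformBits js (ω [ x ]≔ b)) (λ ω′ → ⟦ agree (lowerMask lp) s ω′ ⟧) *ℚ ⟦ 2 ℕ.^ length js ⟧
    ≡⟨ 𝔼-uniformBits-agree s js (ω [ x ]≔ b) (lowerMask lp) M (skipped-unique k lv lp) on off M≡lowerMask-lp ⟩
  ⟦ agree M s (ω [ x ]≔ b) ⟧
    ≡⟨ cong ⟦_⟧ (agree-update M (lowerMask lv) s ω x b M-x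
                   (dec-false (varLevel x ≤? lv) (ℕ.<⇒≱ (subst (lv <_) (sym x-at-lp) lv<lp))) M-off-x) ⟩
  ⟦ agreeBit (lookup s x) b ℕ.* agree (lowerMask lv) s ω ⟧
    ∎
  where
  open ≡-Reasoning
  js = skipped k lv lp
  M : Mask k
  M j = if does (j Fin.≟ x) then true else lowerMask lv j
  M-x : M x ≡ true
  M-x rewrite dec-true (x Fin.≟ x) refl = refl
  M-off-x : ∀ j → j ≢ x → lowerMask lv j ≡ M j
  M-off-x j j≢x rewrite dec-false (j Fin.≟ x) j≢x = refl
  on : ∀ i → i ∈ js → lowerMask lp i ≡ true
  on i i∈js = dec-true (varLevel i ≤? lp) (ℕ.<⇒≤ (proj₂ (skipped⁻ i∈js)))
  off : ∀ i → i ∈ js → M i ≡ false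
  off i i∈js with i Fin.≟ x
  ... | yes refl = ⊥-elim (ℕ.<-irrefl x-at-lp (proj₂ (skipped⁻ i∈js)))
  ... | no  _    = dec-false (varLevel i ≤? lv) (ℕ.<⇒≱ (proj₁ (skipped⁻ i∈js)))
  M≡lowerMask-lp : ∀ i → i ∉ js → M i ≡ lowerMask lp i
  M≡lowerMask-lp i i∉js with i Fin.≟ x
  ... | yes refl = sym (dec-true (varLevel i ≤? lp) (ℕ.≤-reflexive x-at-lp))
  ... | no  i≢x with varLevel i ≤? lv
  ...   | yes i≤lv = trans (dec-true (varLevel i ≤? lv) i≤lv) (sym (dec-true (varLevel i ≤? lp) (ℕ.≤-trans i≤lv (ℕ.<⇒≤ lv<lp))))
  ...   | no  i≰lv with varLevel i <? lp
  ...     | yes i<lp = ⊥-elim (i∉js (skipped⁺ (ℕ.≰⇒> i≰lv) i<lp))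
  ...     | no  i≮lp = trans (dec-false (varLevel i ≤? lv) i≰lv) (sym (dec-false (varLevel i ≤? lp)
                         (λ i≤lp → i≢x (varLevel-injective (trans (ℕ.≤-antisym i≤lp (ℕ.≮⇒≥ i≮lp)) (sym x-at-lp))))))

-- parentEdges and leafWeights are concatMaps of helpers local to Defs; concatMapped recovers
-- such a helper by unification, so that it can be named.
concatMapped : ∀ {A B : Set} {e : A → List B} (xs : List A) {ys : List B} → ys ≡ concatMap e xs → A → List B
concatMapped {e = e} _ _ = e

parentEdgesAt : ∀ {k} (D : ADD k) → Fin (size D) → Fin (size D) → List (Fin (size D) × Fin k × Bool)
parentEdgesAt D v = concatMapped (allFin (size D)) (refl {x = parentEdges D v})

leafWeightsAt : ∀ {k} (D : ADD k) → Fin (size D) → List (Fin (size D) × ℕ)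
leafWeightsAt D = concatMapped (allFin (size D)) (refl {x = leafWeights D})

module _ {k} (D : ADD k) where

  parentSum : Fin (size D) → (Fin (size D) → Fin k → Bool → ℕ) → Fin (size D) → Node k (size D) → ℕ
  parentSum v F p (leaf _)     = 0
  parentSum v F p (node x l h) = (if does (l Fin.≟ v) then F p x false else 0) ℕ.+ (if does (h Fin.≟ v) then F p x true else 0)

  sumℕ-parentEdges : ∀ v (F : Fin (size D) → Fin k → Bool → ℕ) →
    sumℕ (parentEdges D v) (λ e → F (proj₁ e) (proj₁ (proj₂ e)) (proj₂ (proj₂ e)))
      ≡ sumℕ (allFin (size D)) (λ p → parentSum v F p (nodes D p))
  sumℕ-parentEdges v F = trans (sumℕ-concatMap (parentEdgesAt D v) (allFin (size D)) F′) (sumℕ-cong (allFin (size D)) at)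
    where
    F′ : Fin (size D) × Fin k × Bool → ℕ
    F′ e = F (proj₁ e) (proj₁ (proj₂ e)) (proj₂ (proj₂ e))
    at : ∀ p → sumℕ (parentEdgesAt D v p) F′ ≡ parentSum v F p (nodes D p)
    at p with nodes D p
    ... | leaf _ = refl
    ... | node x l h with does (l Fin.≟ v) | does (h Fin.≟ v)
    ...   | true  | true  = cong (F p x false ℕ.+_) (ℕ.+-identityʳ _)
    ...   | true  | false = refl
    ...   | false | true  = ℕ.+-identityʳ _
    ...   | false | false = refl

  IsParentEdge : Fin (size D) → Fin (size D) × Fin k × Bool → Set
  IsParentEdge v (p , x , b) = Σ (Fin (size D)) λ l → Σ (Fin (size D)) λ h → nodes D p ≡ node x l h × (if b then h else l) ≡ v

  parentEdges-sound : ∀ {v e} → e ∈ parentEdges D v → IsParentEdge v e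
  parentEdges-sound {v} {e} e∈ = at (proj₁ witness) (proj₂ witness)
    where
    witness = satisfied (∈-concatMap⁻ (parentEdgesAt D v) {xs = allFin (size D)} e∈)
    at : ∀ p → e ∈ parentEdgesAt D v p → IsParentEdge v e
    at p e∈p with nodes D p in eq
    at p () | leaf _
    ... | node x l h with l Fin.≟ v | h Fin.≟ v
    at p (here refl)         | node x l h | yes refl | yes refl = l , l , eq , refl
    at p (there (here refl)) | node x l h | yes refl | yes refl = l , l , eq , refl
    at p (here refl)         | node x l h | yes refl | no  _    = l , h , eq , refl
    at p (here refl)         | node x l h | no  _    | yes refl = l , h , eq , refl
    at p ()                  | node x l h | no  _    | no  _

  lvl≤k : ∀ v → lvl D v ≤ k
  lvl≤k v with nodes D v
  ... | leaf _     = z≤n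
  ... | node x _ _ = ℕ.m∸n≤m k (toℕ x)

module WellFormed {k} (D : ADD k) (wf : WellFormedADD D) where

  private
    ordered : Ordered D
    ordered = proj₁ wf

  lvl≤lvl-root : ∀ v → lvl D v ≤ lvl D (root D)
  lvl≤lvl-root v = below (proj₂ (proj₂ wf) v)
    where
    below : ∀ {v} → Reach D v → lvl D v ≤ lvl D (root D)
    below here                             = ℕ.≤-refl
    below (viaLo {p} {x} {l} {h} reach eq) = ℕ.<⇒≤ (ℕ.<-≤-trans (proj₁ (ordered p x l h eq)) (below reach))
    below (viaHi {p} {x} {l} {h} reach eq) = ℕ.<⇒≤ (ℕ.<-≤-trans (proj₂ (ordered p x l h eq)) (below reach))

  lvl<lvl-root : ∀ v → v ≢ root D → lvl D v < lvl D (root D)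
  lvl<lvl-root v = strictlyBelow (proj₂ (proj₂ wf) v)
    where
    strictlyBelow : ∀ {v} → Reach D v → v ≢ root D → lvl D v < lvl D (root D)
    strictlyBelow here                         v≢root = ⊥-elim (v≢root refl)
    strictlyBelow (viaLo {p} {x} {l} {h} _ eq) _      = ℕ.<-≤-trans (proj₁ (ordered p x l h eq)) (lvl≤lvl-root p)
    strictlyBelow (viaHi {p} {x} {l} {h} _ eq) _      = ℕ.<-≤-trans (proj₂ (ordered p x l h eq)) (lvl≤lvl-root p)

  [≟]-lvl< : ∀ {u v} → lvl D u < lvl D v → [ u ≟ v ] ≡ 0
  [≟]-lvl< {u} {v} u<v = [≟]-≢ {i = u} {v} λ { refl → ℕ.<-irrefl refl u<v }

  lvl<lvl-parent : ∀ {v p x b} → (p , x , b) ∈ parentEdges D v → lvl D v < lvl D p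
  lvl<lvl-parent {v} {p} {x} {b} e∈ with parentEdges-sound D e∈
  ... | l , h , eq , refl with b
  ...   | true  = proj₂ (ordered p x l h eq)
  ...   | false = proj₁ (ordered p x l h eq)

  lvl-parent≡varLevel : ∀ {v p x b} → (p , x , b) ∈ parentEdges D v → lvl D p ≡ varLevel x
  lvl-parent≡varLevel e∈ with parentEdges-sound D e∈
  ... | _ , _ , eq , _ = cong level eq

  parentEdges-root : parentEdges D (root D) ≡ []
  parentEdges-root with parentEdges D (root D) in eq
  ... | []              = refl
  ... | (p , x , b) ∷ _ = ⊥-elim (ℕ.<-irrefl refl
          (ℕ.<-≤-trans (lvl<lvl-parent (subst ((p , x , b) ∈_) (sym eq) (here refl))) (lvl≤lvl-root p)))

  PiFrom-fuel : ∀ f f′ v → lvl D (root D) ∸ lvl D v < f → lvl D (root D) ∸ lvl D v < f′ → PiFrom D f v ≡ PiFrom D f′ v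
  PiFrom-fuel (suc f) (suc f′) v v<f v<f′ = cong ([ v ≟ root D ] ℕ.+_)
    (sumℕ-cong∈ (parentEdges D v) λ e e∈ → cong (2 ℕ.^ gap D (proj₁ e) v ℕ.*_)
      (PiFrom-fuel f f′ (proj₁ e) (ℕ.<-≤-trans (closer e∈) (ℕ.≤-pred v<f)) (ℕ.<-≤-trans (closer e∈) (ℕ.≤-pred v<f′))))
    where
    closer : ∀ {p x b} → (p , x , b) ∈ parentEdges D v → lvl D (root D) ∸ lvl D p < lvl D (root D) ∸ lvl D v
    closer {p} e∈ = ℕ.∸-monoʳ-< (lvl<lvl-parent e∈) (lvl≤lvl-root p)

  Pi-root : Pi D (root D) ≡ 1
  Pi-root = begin
    Pi D (root D)
      ≡⟨ cong (λ es → [ root D ≟ root D ] ℕ.+ sumℕ es (λ e → 2 ℕ.^ gap D (proj₁ e) (root D) ℕ.* PiFrom D k (proj₁ e)))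
              parentEdges-root ⟩
    [ root D ≟ root D ] ℕ.+ 0
      ≡⟨ ℕ.+-identityʳ _ ⟩
    [ root D ≟ root D ]
      ≡⟨ [≟]-refl (root D) ⟩
    1
      ∎
    where open ≡-Reasoning

  Pi-parentEdges : ∀ v → v ≢ root D → Pi D v ≡ sumℕ (parentEdges D v) (λ e → 2 ℕ.^ gap D (proj₁ e) v ℕ.* Pi D (proj₁ e))
  Pi-parentEdges v v≢root = cong₂ ℕ._+_ ([≟]-≢ v≢root)
    (sumℕ-cong∈ (parentEdges D v) λ e e∈ → cong (2 ℕ.^ gap D (proj₁ e) v ℕ.*_) (PiFrom-fuel k (suc k) (proj₁ e)
      (within e∈) (ℕ.<-≤-trans (within e∈) (ℕ.n≤1+n k))))
    where
    within : ∀ {p x b} → (p , x , b) ∈ parentEdges D v → lvl D (root D) ∸ lvl D p < k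
    within {p} e∈ = ℕ.<-≤-trans (ℕ.∸-monoʳ-< (lvl<lvl-parent e∈) (lvl≤lvl-root p))
                                (ℕ.≤-trans (ℕ.m∸n≤m _ (lvl D v)) (lvl≤k D (root D)))

  module EvalPath (s : State k) where

    branch : Fin k → Fin (size D) → Fin (size D) → Fin (size D)
    branch x l h = if lookup s x then h else l

    mutual
      pathFrom : ℕ → Fin (size D) → List (Fin (size D))
      pathFrom zero    u = []
      pathFrom (suc f) u = u ∷ pathBelow f (nodes D u)

      pathBelow : ℕ → Node k (size D) → List (Fin (size D))
      pathBelow f (leaf _)     = []
      pathBelow f (node x l h) = pathFrom f (branch x l h)

    onPath : Fin (size D) → ℕ
    onPath v = occurrences v (pathFrom (suc k) (root D))

    branch-lvl : ∀ {u x l h} → nodes D u ≡ node x l h → lvl D (branch x l h) < lvl D u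
    branch-lvl {u} {x} {l} {h} eq with lookup s x
    ... | true  = proj₂ (ordered u x l h eq)
    ... | false = proj₁ (ordered u x l h eq)

    occurrences-below : ∀ f u v → lvl D u < lvl D v → occurrences v (pathFrom f u) ≡ 0
    occurrences-pathBelow : ∀ f u v → lvl D u ≤ lvl D v → occurrences v (pathBelow f (nodes D u)) ≡ 0

    occurrences-below zero    u v _   = refl
    occurrences-below (suc f) u v u<v = cong₂ ℕ._+_ ([≟]-lvl< u<v) (occurrences-pathBelow f u v (ℕ.<⇒≤ u<v))

    occurrences-pathBelow f u v u≤v = below (nodes D u) refl
      where
      below : ∀ nd → nodes D u ≡ nd → occurrences v (pathBelow f nd) ≡ 0
      below (leaf _)     _  = refl
      below (node x l h) eq = occurrences-below f _ v (ℕ.<-≤-trans (branch-lvl eq) u≤v)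

    onPath-root : onPath (root D) ≡ 1
    onPath-root = cong₂ ℕ._+_ ([≟]-refl (root D)) (occurrences-pathBelow k (root D) (root D) ℕ.≤-refl)

    stepsTo : Fin (size D) → Node k (size D) → ℕ
    stepsTo v (leaf _)     = 0
    stepsTo v (node x l h) = [ branch x l h ≟ v ]

    occurrences-pathFrom : ∀ f u v → lvl D u < f →
      sumℕ (pathFrom f u) (λ p → stepsTo v (nodes D p)) ℕ.+ [ u ≟ v ] ≡ occurrences v (pathFrom f u)
    occurrences-pathFrom (suc f) u v u<f with nodes D u in eq
    ... | leaf _     = ℕ.+-comm 0 [ u ≟ v ]
    ... | node x l h = begin
      [ u′ ≟ v ] ℕ.+ steps ℕ.+ [ u ≟ v ]    ≡⟨ ℕ.+-comm ([ u′ ≟ v ] ℕ.+ steps) [ u ≟ v ] ⟩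
      [ u ≟ v ] ℕ.+ ([ u′ ≟ v ] ℕ.+ steps)  ≡⟨ cong ([ u ≟ v ] ℕ.+_) (ℕ.+-comm [ u′ ≟ v ] steps) ⟩
      [ u ≟ v ] ℕ.+ (steps ℕ.+ [ u′ ≟ v ])  ≡⟨ cong ([ u ≟ v ] ℕ.+_) (occurrences-pathFrom f u′ v u′<f) ⟩
      [ u ≟ v ] ℕ.+ occurrences v (pathFrom f u′) ∎
      where
      open ≡-Reasoning
      u′ = branch x l h
      steps = sumℕ (pathFrom f u′) (λ p → stepsTo v (nodes D p))
      u′<f : lvl D u′ < f
      u′<f = ℕ.<-≤-trans (subst (lvl D u′ <_) (cong level eq) (branch-lvl eq)) (ℕ.≤-pred u<f)

    onPath-parentEdges : ∀ v → v ≢ root D →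
      sumℕ (parentEdges D v) (λ e → agreeBit (lookup s (proj₁ (proj₂ e))) (proj₂ (proj₂ e)) ℕ.* onPath (proj₁ e)) ≡ onPath v
    onPath-parentEdges v v≢root = begin
      sumℕ (parentEdges D v) (λ e → agreeBit (lookup s (proj₁ (proj₂ e))) (proj₂ (proj₂ e)) ℕ.* onPath (proj₁ e))
        ≡⟨ sumℕ-parentEdges D v F ⟩
      sumℕ (allFin (size D)) (λ p → parentSum D v F p (nodes D p))
        ≡⟨ sumℕ-cong (allFin (size D)) (λ p → trans (parentSum-agree p (nodes D p)) (ℕ.*-comm (stepsTo v (nodes D p)) (onPath p))) ⟩
      sumℕ (allFin (size D)) (λ p → onPath p ℕ.* stepsTo v (nodes D p))
        ≡⟨ sumℕ-allFin-occurrences path (λ p → stepsTo v (nodes D p)) ⟩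
      sumℕ path (λ p → stepsTo v (nodes D p))
        ≡⟨ ℕ.+-identityʳ _ ⟨
      sumℕ path (λ p → stepsTo v (nodes D p)) ℕ.+ 0
        ≡⟨ cong (sumℕ path (λ p → stepsTo v (nodes D p)) ℕ.+_) ([≟]-≢ (v≢root ∘ sym)) ⟨
      sumℕ path (λ p → stepsTo v (nodes D p)) ℕ.+ [ root D ≟ v ]
        ≡⟨ occurrences-pathFrom (suc k) (root D) v (s≤s (lvl≤k D (root D))) ⟩
      onPath v
        ∎
      where
      open ≡-Reasoning
      path = pathFrom (suc k) (root D)
      F : Fin (size D) → Fin k → Bool → ℕ
      F p x b = agreeBit (lookup s x) b ℕ.* onPath p
      parentSum-agree : ∀ p nd → parentSum D v F p nd ≡ stepsTo v nd ℕ.* onPath p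
      parentSum-agree p (leaf _)     = refl
      parentSum-agree p (node x l h) with lookup s x
      ... | true  with does (l Fin.≟ v) | does (h Fin.≟ v)
      ...   | true  | true  = refl
      ...   | false | true  = refl
      ...   | true  | false = refl
      ...   | false | false = refl
      parentSum-agree p (node x l h) | false with does (l Fin.≟ v) | does (h Fin.≟ v)
      ...   | true  | true  = ℕ.+-identityʳ _
      ...   | true  | false = ℕ.+-identityʳ _
      ...   | false | true  = refl
      ...   | false | false = refl

    leafValue : Node k (size D) → ℕ
    leafValue (leaf a)     = a
    leafValue (node _ _ _) = 0

    sumℕ-pathFrom-leafValue : ∀ f u → sumℕ (pathFrom f u) (leafValue ∘ nodes D) ≡ evalFrom D f s u
    sumℕ-pathFrom-leafValue zero    u = refl
    sumℕ-pathFrom-leafValue (suc f) u with nodes D u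
    ... | leaf a     = ℕ.+-identityʳ a
    ... | node x l h with lookup s x
    ...   | true  = sumℕ-pathFrom-leafValue f h
    ...   | false = sumℕ-pathFrom-leafValue f l

    eval≡sumℕ-onPath : eval D s ≡ sumℕ (allFin (size D)) (λ p → onPath p ℕ.* leafValue (nodes D p))
    eval≡sumℕ-onPath = sym (trans (sumℕ-allFin-occurrences (pathFrom (suc k) (root D)) (leafValue ∘ nodes D))
                                  (sumℕ-pathFrom-leafValue (suc k) (root D)))

  resample : Fin (size D) → State k → Fin (size D) × Fin k × Bool → Dist (State k)
  resample v ω (p , x , b) = uniformBits (skipped k (lvl D v) (lvl D p)) (ω [ x ]≔ b)

  walkUp-root : ∀ f ω → walkUp D (suc f) (root D) ω ≡ uniformBits (skipped k (lvl D (root D)) (suc k)) ω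
  walkUp-root f ω with root D Fin.≟ root D
  ... | yes _         = refl
  ... | no  root≢root = ⊥-elim (root≢root refl)

  walkUp-step : ∀ f v ω → v ≢ root D →
    walkUp D (suc f) v ω ≡ (choose (map (λ e → e , 2 ℕ.^ gap D (proj₁ e) v ℕ.* Pi D (proj₁ e)) (parentEdges D v)) >>= λ e →
                            resample v ω e >>= walkUp D f (proj₁ e))
  walkUp-step f v ω v≢root with v Fin.≟ root D
  ... | yes v≡root = ⊥-elim (v≢root v≡root)
  ... | no  _      = refl

  𝔼-walkUp-step : ∀ f v ω g → v ≢ root D →
    𝔼 (walkUp D (suc f) v ω) g *ℚ ⟦ Pi D v ⟧
      ≡ sumℚ (parentEdges D v) (λ e → ⟦ 2 ℕ.^ gap D (proj₁ e) v ⟧ *ℚ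
                                       𝔼 (resample v ω e) (λ ω′ → 𝔼 (walkUp D f (proj₁ e) ω′) g *ℚ ⟦ Pi D (proj₁ e) ⟧))
  𝔼-walkUp-step f v ω g v≢root = begin
    𝔼 (walkUp D (suc f) v ω) g *ℚ ⟦ Pi D v ⟧
      ≡⟨ cong₂ (λ d m → 𝔼 d g *ℚ ⟦ m ⟧) (walkUp-step f v ω v≢root)
               (trans (Pi-parentEdges v v≢root) (sym (sumℕ-map (λ e → e , weight e) (parentEdges D v) proj₂))) ⟩
    𝔼 (choose weighted >>= climb) g *ℚ ⟦ sumℕ weighted proj₂ ⟧
      ≡⟨ cong (_*ℚ ⟦ sumℕ weighted proj₂ ⟧) (𝔼-bind (choose weighted) climb g) ⟩
    𝔼 (choose weighted) H *ℚ ⟦ sumℕ weighted proj₂ ⟧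
      ≡⟨ 𝔼-choose weighted H ⟩
    sumℚ weighted (λ ew → ⟦ proj₂ ew ⟧ *ℚ H (proj₁ ew))
      ≡⟨ sumℚ-map (λ e → e , weight e) (parentEdges D v) (λ ew → ⟦ proj₂ ew ⟧ *ℚ H (proj₁ ew)) ⟩
    sumℚ (parentEdges D v) (λ e → ⟦ weight e ⟧ *ℚ H e)
      ≡⟨ sumℚ-cong (parentEdges D v) per-edge ⟩
    sumℚ (parentEdges D v) (λ e → ⟦ 2 ℕ.^ gap D (proj₁ e) v ⟧ *ℚ
                                   𝔼 (resample v ω e) (λ ω′ → 𝔼 (walkUp D f (proj₁ e) ω′) g *ℚ ⟦ Pi D (proj₁ e) ⟧))
      ∎
    where
    open ≡-Reasoning
    weight : Fin (size D) × Fin k × Bool → ℕ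
    weight e = 2 ℕ.^ gap D (proj₁ e) v ℕ.* Pi D (proj₁ e)
    weighted = map (λ e → e , weight e) (parentEdges D v)
    climb : Fin (size D) × Fin k × Bool → Dist (State k)
    climb e = resample v ω e >>= walkUp D f (proj₁ e)
    H : Fin (size D) × Fin k × Bool → ℚ
    H e = 𝔼 (climb e) g
    per-edge : ∀ e → ⟦ weight e ⟧ *ℚ H e
                   ≡ ⟦ 2 ℕ.^ gap D (proj₁ e) v ⟧ *ℚ 𝔼 (resample v ω e) (λ ω′ → 𝔼 (walkUp D f (proj₁ e) ω′) g *ℚ ⟦ Pi D (proj₁ e) ⟧)
    per-edge e = begin
      ⟦ 2 ℕ.^ gap D (proj₁ e) v ℕ.* Pi D (proj₁ e) ⟧ *ℚ H e
        ≡⟨ cong (_*ℚ H e) (⟦⟧-homo-* (2 ℕ.^ gap D (proj₁ e) v) (Pi D (proj₁ e))) ⟩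
      ⟦ 2 ℕ.^ gap D (proj₁ e) v ⟧ *ℚ ⟦ Pi D (proj₁ e) ⟧ *ℚ H e
        ≡⟨ ℚ*.xy∙z≈x∙zy ⟦ 2 ℕ.^ gap D (proj₁ e) v ⟧ ⟦ Pi D (proj₁ e) ⟧ (H e) ⟩
      ⟦ 2 ℕ.^ gap D (proj₁ e) v ⟧ *ℚ (H e *ℚ ⟦ Pi D (proj₁ e) ⟧)
        ≡⟨ cong (λ r → ⟦ 2 ℕ.^ gap D (proj₁ e) v ⟧ *ℚ (r *ℚ ⟦ Pi D (proj₁ e) ⟧)) (𝔼-bind (resample v ω e) (walkUp D f (proj₁ e)) g) ⟩
      ⟦ 2 ℕ.^ gap D (proj₁ e) v ⟧ *ℚ (𝔼 (resample v ω e) (λ ω′ → 𝔼 (walkUp D f (proj₁ e) ω′) g) *ℚ ⟦ Pi D (proj₁ e) ⟧)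
        ≡⟨ cong (⟦ 2 ℕ.^ gap D (proj₁ e) v ⟧ *ℚ_) (𝔼-*ʳ (resample v ω e) (λ ω′ → 𝔼 (walkUp D f (proj₁ e) ω′) g) ⟦ Pi D (proj₁ e) ⟧) ⟨
      ⟦ 2 ℕ.^ gap D (proj₁ e) v ⟧ *ℚ 𝔼 (resample v ω e) (λ ω′ → 𝔼 (walkUp D f (proj₁ e) ω′) g *ℚ ⟦ Pi D (proj₁ e) ⟧)
        ∎

  -- walkUp climbs on fuel; lvl D (root D) ≤ f + lvl D v ensures that the fuel never runs out.
  fuel-parent : ∀ {f v p x b} → lvl D (root D) ≤ suc f ℕ.+ lvl D v → (p , x , b) ∈ parentEdges D v →
    lvl D (root D) ≤ f ℕ.+ lvl D p
  fuel-parent {f} {v} fuel e∈ = ℕ.≤-trans fuel (ℕ.≤-trans (ℕ.≤-reflexive (sym (ℕ.+-suc f (lvl D v))))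
                                                         (ℕ.+-monoʳ-≤ f (lvl<lvl-parent e∈)))

  𝔼-walkUp-1 : ∀ f v ω → lvl D (root D) ≤ f ℕ.+ lvl D v → 𝔼 (walkUp D (suc f) v ω) (λ _ → 1ℚ) *ℚ ⟦ Pi D v ⟧ ≡ ⟦ Pi D v ⟧
  𝔼-walkUp-1 f v ω fuel = at-root? (v Fin.≟ root D) f fuel
    where
    at-root? : Dec (v ≡ root D) → ∀ f → lvl D (root D) ≤ f ℕ.+ lvl D v →
      𝔼 (walkUp D (suc f) v ω) (λ _ → 1ℚ) *ℚ ⟦ Pi D v ⟧ ≡ ⟦ Pi D v ⟧
    at-root? (yes refl) f _ = trans (cong (λ d → 𝔼 d (λ _ → 1ℚ) *ℚ ⟦ Pi D (root D) ⟧) (walkUp-root f ω))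
                                    (trans (cong (_*ℚ ⟦ Pi D (root D) ⟧) (𝔼-uniformBits-1 (skipped k (lvl D (root D)) (suc k)) ω)) (ℚ.*-identityˡ _))
    at-root? (no v≢root) zero     fuel = ⊥-elim (ℕ.<⇒≱ (lvl<lvl-root v v≢root) fuel)
    at-root? (no v≢root) (suc f′) fuel = begin
      𝔼 (walkUp D (suc (suc f′)) v ω) (λ _ → 1ℚ) *ℚ ⟦ Pi D v ⟧
        ≡⟨ 𝔼-walkUp-step (suc f′) v ω (λ _ → 1ℚ) v≢root ⟩
      sumℚ (parentEdges D v) (λ e → ⟦ 2 ℕ.^ gap D (proj₁ e) v ⟧ *ℚ
                                     𝔼 (resample v ω e) (λ ω′ → 𝔼 (walkUp D (suc f′) (proj₁ e) ω′) (λ _ → 1ℚ) *ℚ ⟦ Pi D (proj₁ e) ⟧))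
        ≡⟨ sumℚ-cong∈ (parentEdges D v) (λ e e∈ → cong (⟦ 2 ℕ.^ gap D (proj₁ e) v ⟧ *ℚ_)
             (trans (𝔼-cong (resample v ω e) (λ ω′ → 𝔼-walkUp-1 f′ (proj₁ e) ω′ (fuel-parent fuel e∈)))
                    (𝔼-uniformBits-const (skipped k (lvl D v) (lvl D (proj₁ e))) (ω [ proj₁ (proj₂ e) ]≔ proj₂ (proj₂ e)) ⟦ Pi D (proj₁ e) ⟧))) ⟩
      sumℚ (parentEdges D v) (λ e → ⟦ 2 ℕ.^ gap D (proj₁ e) v ⟧ *ℚ ⟦ Pi D (proj₁ e) ⟧)
        ≡⟨ sumℚ-cong (parentEdges D v) (λ e → ⟦⟧-homo-* (2 ℕ.^ gap D (proj₁ e) v) (Pi D (proj₁ e))) ⟨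
      sumℚ (parentEdges D v) (λ e → ⟦ 2 ℕ.^ gap D (proj₁ e) v ℕ.* Pi D (proj₁ e) ⟧)
        ≡⟨ ⟦⟧-sumℕ (parentEdges D v) (λ e → 2 ℕ.^ gap D (proj₁ e) v ℕ.* Pi D (proj₁ e)) ⟨
      ⟦ sumℕ (parentEdges D v) (λ e → 2 ℕ.^ gap D (proj₁ e) v ℕ.* Pi D (proj₁ e)) ⟧
        ≡⟨ cong ⟦_⟧ (Pi-parentEdges v v≢root) ⟨
      ⟦ Pi D v ⟧
        ∎
      where open ≡-Reasoning

  leafEntry : Fin (size D) → Node k (size D) → List (Fin (size D) × ℕ)
  leafEntry p (leaf a)     = (p , a ℕ.* Pi D p) ∷ []
  leafEntry p (node _ _ _) = []

  leafWeightsAt≡leafEntry : ∀ p → leafWeightsAt D p ≡ leafEntry p (nodes D p)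
  leafWeightsAt≡leafEntry p with nodes D p
  ... | leaf _     = refl
  ... | node _ _ _ = refl

  totalLeafWeight : ℕ
  totalLeafWeight = sumℕ (leafWeights D) proj₂

  normaliser : ℕ
  normaliser = totalLeafWeight ℕ.* 2 ℕ.^ (k ∸ lvl D (root D))

  fuel-k : ∀ v → lvl D (root D) ≤ k ℕ.+ lvl D v
  fuel-k v = ℕ.≤-trans (lvl≤k D (root D)) (ℕ.m≤m+n k (lvl D v))

  𝔼-sampleADD-1 : 𝔼 (sampleADD D) (λ _ → 1ℚ) *ℚ ⟦ totalLeafWeight ⟧ ≡ ⟦ totalLeafWeight ⟧
  𝔼-sampleADD-1 = begin
    𝔼 (choose (leafWeights D) >>= λ v → walkUp D (suc k) v zeros) (λ _ → 1ℚ) *ℚ ⟦ totalLeafWeight ⟧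
      ≡⟨ cong (_*ℚ ⟦ totalLeafWeight ⟧) (𝔼-bind (choose (leafWeights D)) (λ v → walkUp D (suc k) v zeros) (λ _ → 1ℚ)) ⟩
    𝔼 (choose (leafWeights D)) H *ℚ ⟦ totalLeafWeight ⟧
      ≡⟨ 𝔼-choose (leafWeights D) H ⟩
    sumℚ (leafWeights D) (λ vw → ⟦ proj₂ vw ⟧ *ℚ H (proj₁ vw))
      ≡⟨ sumℚ-concatMap (leafWeightsAt D) (allFin (size D)) _ ⟩
    sumℚ (allFin (size D)) (λ p → sumℚ (leafWeightsAt D p) (λ vw → ⟦ proj₂ vw ⟧ *ℚ H (proj₁ vw)))
      ≡⟨ sumℚ-cong (allFin (size D)) (λ p → trans (cong (λ es → sumℚ es (λ vw → ⟦ proj₂ vw ⟧ *ℚ H (proj₁ vw))) (leafWeightsAt≡leafEntry p))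
                                                  (trans (at p (nodes D p)) (cong (λ es → ⟦ sumℕ es proj₂ ⟧) (sym (leafWeightsAt≡leafEntry p))))) ⟩
    sumℚ (allFin (size D)) (λ p → ⟦ sumℕ (leafWeightsAt D p) proj₂ ⟧)
      ≡⟨ ⟦⟧-sumℕ (allFin (size D)) _ ⟨
    ⟦ sumℕ (allFin (size D)) (λ p → sumℕ (leafWeightsAt D p) proj₂) ⟧
      ≡⟨ cong ⟦_⟧ (sumℕ-concatMap (leafWeightsAt D) (allFin (size D)) proj₂) ⟨
    ⟦ totalLeafWeight ⟧
      ∎
    where
    open ≡-Reasoning
    zeros = replicate k false
    H : Fin (size D) → ℚ
    H v = 𝔼 (walkUp D (suc k) v zeros) (λ _ → 1ℚ)
    at : ∀ p nd → sumℚ (leafEntry p nd) (λ vw → ⟦ proj₂ vw ⟧ *ℚ H (proj₁ vw)) ≡ ⟦ sumℕ (leafEntry p nd) proj₂ ⟧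
    at p (node _ _ _) = sym ⟦0⟧
    at p (leaf a)     = begin
      ⟦ a ℕ.* Pi D p ⟧ *ℚ H p +ℚ 0ℚ           ≡⟨ ℚ.+-identityʳ _ ⟩
      ⟦ a ℕ.* Pi D p ⟧ *ℚ H p                 ≡⟨ cong (_*ℚ H p) (⟦⟧-homo-* a (Pi D p)) ⟩
      ⟦ a ⟧ *ℚ ⟦ Pi D p ⟧ *ℚ H p              ≡⟨ ℚ*.xy∙z≈x∙zy ⟦ a ⟧ ⟦ Pi D p ⟧ (H p) ⟩
      ⟦ a ⟧ *ℚ (H p *ℚ ⟦ Pi D p ⟧)            ≡⟨ cong (⟦ a ⟧ *ℚ_) (𝔼-walkUp-1 k p zeros (fuel-k p)) ⟩
      ⟦ a ⟧ *ℚ ⟦ Pi D p ⟧                     ≡⟨ ⟦⟧-homo-* a (Pi D p) ⟨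
      ⟦ a ℕ.* Pi D p ⟧                        ≡⟨ cong ⟦_⟧ (ℕ.+-identityʳ _) ⟨
      ⟦ a ℕ.* Pi D p ℕ.+ 0 ⟧                  ∎

  module _ (s : State k) where
    open EvalPath s

    𝔼-walkUp-agree : ∀ f v ω → lvl D (root D) ≤ f ℕ.+ lvl D v →
      𝔼 (walkUp D (suc f) v ω) (λ ω′ → ⟦ agree allTrue s ω′ ⟧) *ℚ ⟦ Pi D v ⟧ *ℚ ⟦ 2 ℕ.^ (k ∸ lvl D (root D)) ⟧
        ≡ ⟦ agree (lowerMask (lvl D v)) s ω ℕ.* onPath v ⟧
    𝔼-walkUp-agree f v ω fuel = at-root? (v Fin.≟ root D) f fuel
      where
      G : State k → ℚ
      G ω′ = ⟦ agree allTrue s ω′ ⟧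
      2^R = ⟦ 2 ℕ.^ (k ∸ lvl D (root D)) ⟧
      at-root? : Dec (v ≡ root D) → ∀ f → lvl D (root D) ≤ f ℕ.+ lvl D v →
        𝔼 (walkUp D (suc f) v ω) G *ℚ ⟦ Pi D v ⟧ *ℚ 2^R ≡ ⟦ agree (lowerMask (lvl D v)) s ω ℕ.* onPath v ⟧
      at-root? (yes refl) f _ = begin
        𝔼 (walkUp D (suc f) (root D) ω) G *ℚ ⟦ Pi D (root D) ⟧ *ℚ 2^R
          ≡⟨ cong₂ (λ d m → 𝔼 d G *ℚ ⟦ m ⟧ *ℚ 2^R) (walkUp-root f ω) Pi-root ⟩
        U *ℚ ⟦ 1 ⟧ *ℚ 2^R
          ≡⟨ cong (λ r → U *ℚ r *ℚ 2^R) ⟦1⟧ ⟩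
        U *ℚ 1ℚ *ℚ 2^R
          ≡⟨ cong (_*ℚ 2^R) (ℚ.*-identityʳ U) ⟩
        U *ℚ 2^R
          ≡⟨ 𝔼-uniformBits-above s ω (lvl D (root D)) ⟩
        ⟦ agree (lowerMask (lvl D (root D))) s ω ⟧
          ≡⟨ cong ⟦_⟧ (trans (sym (ℕ.*-identityʳ _)) (cong (agree (lowerMask (lvl D (root D))) s ω ℕ.*_) (sym onPath-root))) ⟩
        ⟦ agree (lowerMask (lvl D (root D))) s ω ℕ.* onPath (root D) ⟧
          ∎
        where
        open ≡-Reasoning
        U = 𝔼 (uniformBits (skipped k (lvl D (root D)) (suc k)) ω) G
      at-root? (no v≢root) zero     fuel = ⊥-elim (ℕ.<⇒≱ (lvl<lvl-root v v≢root) fuel)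
      at-root? (no v≢root) (suc f′) fuel = begin
        𝔼 (walkUp D (suc (suc f′)) v ω) G *ℚ ⟦ Pi D v ⟧ *ℚ 2^R
          ≡⟨ cong (_*ℚ 2^R) (𝔼-walkUp-step (suc f′) v ω G v≢root) ⟩
        sumℚ (parentEdges D v) climb *ℚ 2^R
          ≡⟨ sumℚ-*ʳ (parentEdges D v) climb 2^R ⟨
        sumℚ (parentEdges D v) (λ e → climb e *ℚ 2^R)
          ≡⟨ sumℚ-cong∈ (parentEdges D v) (λ { (p , x , b) e∈ → edge-contribution e∈ }) ⟩
        sumℚ (parentEdges D v) (λ e → ⟦ agreeBit (lookup s (proj₁ (proj₂ e))) (proj₂ (proj₂ e)) ℕ.* onPath (proj₁ e) ℕ.* A ⟧)
          ≡⟨ ⟦⟧-sumℕ (parentEdges D v) _ ⟨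
        ⟦ sumℕ (parentEdges D v) (λ e → agreeBit (lookup s (proj₁ (proj₂ e))) (proj₂ (proj₂ e)) ℕ.* onPath (proj₁ e) ℕ.* A) ⟧
          ≡⟨ cong ⟦_⟧ (sumℕ-*ʳ (parentEdges D v) _ A) ⟩
        ⟦ sumℕ (parentEdges D v) (λ e → agreeBit (lookup s (proj₁ (proj₂ e))) (proj₂ (proj₂ e)) ℕ.* onPath (proj₁ e)) ℕ.* A ⟧
          ≡⟨ cong (λ m → ⟦ m ℕ.* A ⟧) (onPath-parentEdges v v≢root) ⟩
        ⟦ onPath v ℕ.* A ⟧
          ≡⟨ cong ⟦_⟧ (ℕ.*-comm (onPath v) A) ⟩
        ⟦ A ℕ.* onPath v ⟧
          ∎
        where
        open ≡-Reasoning
        A = agree (lowerMask (lvl D v)) s ω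
        climb : Fin (size D) × Fin k × Bool → ℚ
        climb e = ⟦ 2 ℕ.^ gap D (proj₁ e) v ⟧ *ℚ 𝔼 (resample v ω e) (λ ω′ → 𝔼 (walkUp D (suc f′) (proj₁ e) ω′) G *ℚ ⟦ Pi D (proj₁ e) ⟧)
        edge-contribution : ∀ {p x b} → (p , x , b) ∈ parentEdges D v →
          climb (p , x , b) *ℚ 2^R ≡ ⟦ agreeBit (lookup s x) b ℕ.* onPath p ℕ.* A ⟧
        edge-contribution {p} {x} {b} e∈ = begin
          ⟦ 2^gap ⟧ *ℚ 𝔼 resampled (λ ω′ → 𝔼 (walkUp D (suc f′) p ω′) G *ℚ ⟦ Pi D p ⟧) *ℚ 2^R
            ≡⟨ ℚ.*-assoc ⟦ 2^gap ⟧ (𝔼 resampled (λ ω′ → 𝔼 (walkUp D (suc f′) p ω′) G *ℚ ⟦ Pi D p ⟧)) 2^R ⟩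
          ⟦ 2^gap ⟧ *ℚ (𝔼 resampled (λ ω′ → 𝔼 (walkUp D (suc f′) p ω′) G *ℚ ⟦ Pi D p ⟧) *ℚ 2^R)
            ≡⟨ cong (⟦ 2^gap ⟧ *ℚ_) (𝔼-*ʳ resampled (λ ω′ → 𝔼 (walkUp D (suc f′) p ω′) G *ℚ ⟦ Pi D p ⟧) 2^R) ⟨
          ⟦ 2^gap ⟧ *ℚ 𝔼 resampled (λ ω′ → 𝔼 (walkUp D (suc f′) p ω′) G *ℚ ⟦ Pi D p ⟧ *ℚ 2^R)
            ≡⟨ cong (⟦ 2^gap ⟧ *ℚ_) (𝔼-cong resampled (λ ω′ → trans (𝔼-walkUp-agree f′ p ω′ (fuel-parent fuel e∈))
                                                             (⟦⟧-homo-* (agree (lowerMask (lvl D p)) s ω′) (onPath p)))) ⟩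
          ⟦ 2^gap ⟧ *ℚ 𝔼 resampled (λ ω′ → ⟦ agree (lowerMask (lvl D p)) s ω′ ⟧ *ℚ ⟦ onPath p ⟧)
            ≡⟨ cong (⟦ 2^gap ⟧ *ℚ_) (𝔼-*ʳ resampled (λ ω′ → ⟦ agree (lowerMask (lvl D p)) s ω′ ⟧) ⟦ onPath p ⟧) ⟩
          ⟦ 2^gap ⟧ *ℚ (𝔼 resampled (λ ω′ → ⟦ agree (lowerMask (lvl D p)) s ω′ ⟧) *ℚ ⟦ onPath p ⟧)
            ≡⟨ ℚ*.x∙yz≈yx∙z ⟦ 2^gap ⟧ (𝔼 resampled (λ ω′ → ⟦ agree (lowerMask (lvl D p)) s ω′ ⟧)) ⟦ onPath p ⟧ ⟩
          𝔼 resampled (λ ω′ → ⟦ agree (lowerMask (lvl D p)) s ω′ ⟧) *ℚ ⟦ 2^gap ⟧ *ℚ ⟦ onPath p ⟧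
            ≡⟨ cong (_*ℚ ⟦ onPath p ⟧) (𝔼-uniformBits-between s ω x b (lvl<lvl-parent e∈) (sym (lvl-parent≡varLevel e∈))) ⟩
          ⟦ agreeBit (lookup s x) b ℕ.* A ⟧ *ℚ ⟦ onPath p ⟧
            ≡⟨ ⟦⟧-homo-* (agreeBit (lookup s x) b ℕ.* A) (onPath p) ⟨
          ⟦ agreeBit (lookup s x) b ℕ.* A ℕ.* onPath p ⟧
            ≡⟨ cong ⟦_⟧ (ℕ*.xy∙z≈xz∙y (agreeBit (lookup s x) b) A (onPath p)) ⟩
          ⟦ agreeBit (lookup s x) b ℕ.* onPath p ℕ.* A ⟧
            ∎
          where
          resampled = resample v ω (p , x , b)
          2^gap = 2 ℕ.^ gap D p v

    𝔼-sampleADD-agree : 𝔼 (sampleADD D) (λ ω → ⟦ agree allTrue s ω ⟧) *ℚ ⟦ normaliser ⟧ ≡ ⟦ eval D s ⟧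
    𝔼-sampleADD-agree = begin
      𝔼 (sampleADD D) G *ℚ ⟦ totalLeafWeight ℕ.* 2 ℕ.^ (k ∸ lvl D (root D)) ⟧
        ≡⟨ cong (𝔼 (sampleADD D) G *ℚ_) (⟦⟧-homo-* totalLeafWeight (2 ℕ.^ (k ∸ lvl D (root D)))) ⟩
      𝔼 (sampleADD D) G *ℚ (⟦ totalLeafWeight ⟧ *ℚ 2^R)
        ≡⟨ ℚ.*-assoc (𝔼 (sampleADD D) G) ⟦ totalLeafWeight ⟧ 2^R ⟨
      𝔼 (choose (leafWeights D) >>= λ v → walkUp D (suc k) v zeros) G *ℚ ⟦ totalLeafWeight ⟧ *ℚ 2^R
        ≡⟨ cong (λ r → r *ℚ ⟦ totalLeafWeight ⟧ *ℚ 2^R) (𝔼-bind (choose (leafWeights D)) (λ v → walkUp D (suc k) v zeros) G) ⟩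
      𝔼 (choose (leafWeights D)) H *ℚ ⟦ totalLeafWeight ⟧ *ℚ 2^R
        ≡⟨ cong (_*ℚ 2^R) (𝔼-choose (leafWeights D) H) ⟩
      sumℚ (leafWeights D) F *ℚ 2^R
        ≡⟨ cong (_*ℚ 2^R) (sumℚ-concatMap (leafWeightsAt D) (allFin (size D)) F) ⟩
      sumℚ (allFin (size D)) (λ p → sumℚ (leafWeightsAt D p) F) *ℚ 2^R
        ≡⟨ sumℚ-*ʳ (allFin (size D)) (λ p → sumℚ (leafWeightsAt D p) F) 2^R ⟨
      sumℚ (allFin (size D)) (λ p → sumℚ (leafWeightsAt D p) F *ℚ 2^R)
        ≡⟨ sumℚ-cong (allFin (size D)) (λ p → trans (cong (λ es → sumℚ es F *ℚ 2^R) (leafWeightsAt≡leafEntry p)) (at p (nodes D p) refl)) ⟩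
      sumℚ (allFin (size D)) (λ p → ⟦ onPath p ℕ.* leafValue (nodes D p) ⟧)
        ≡⟨ ⟦⟧-sumℕ (allFin (size D)) (λ p → onPath p ℕ.* leafValue (nodes D p)) ⟨
      ⟦ sumℕ (allFin (size D)) (λ p → onPath p ℕ.* leafValue (nodes D p)) ⟧
        ≡⟨ cong ⟦_⟧ eval≡sumℕ-onPath ⟨
      ⟦ eval D s ⟧
        ∎
      where
      open ≡-Reasoning
      zeros = replicate k false
      G : State k → ℚ
      G ω = ⟦ agree allTrue s ω ⟧
      2^R = ⟦ 2 ℕ.^ (k ∸ lvl D (root D)) ⟧
      H : Fin (size D) → ℚ
      H v = 𝔼 (walkUp D (suc k) v zeros) G
      F : Fin (size D) × ℕ → ℚ
      F vw = ⟦ proj₂ vw ⟧ *ℚ H (proj₁ vw)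
      at : ∀ p nd → nodes D p ≡ nd → sumℚ (leafEntry p nd) F *ℚ 2^R ≡ ⟦ onPath p ℕ.* leafValue nd ⟧
      at p (node _ _ _) _  = trans (ℚ.*-zeroˡ 2^R) (trans (sym ⟦0⟧) (cong ⟦_⟧ (sym (ℕ.*-zeroʳ (onPath p)))))
      at p (leaf a)     eq = begin
        (⟦ a ℕ.* Pi D p ⟧ *ℚ H p +ℚ 0ℚ) *ℚ 2^R
          ≡⟨ cong (λ r → (r *ℚ H p +ℚ 0ℚ) *ℚ 2^R) (⟦⟧-homo-* a (Pi D p)) ⟩
        (⟦ a ⟧ *ℚ ⟦ Pi D p ⟧ *ℚ H p +ℚ 0ℚ) *ℚ 2^R
          ≡⟨ solve 4 (λ a π h r → (a :* π :* h :+ con 0ℚ) :* r := a :* (h :* π :* r)) refl ⟦ a ⟧ ⟦ Pi D p ⟧ (H p) 2^R ⟩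
        ⟦ a ⟧ *ℚ (H p *ℚ ⟦ Pi D p ⟧ *ℚ 2^R)
          ≡⟨ cong (⟦ a ⟧ *ℚ_) (𝔼-walkUp-agree k p zeros (fuel-k p)) ⟩
        ⟦ a ⟧ *ℚ ⟦ agree (lowerMask (lvl D p)) s zeros ℕ.* onPath p ⟧
          ≡⟨ cong (λ L → ⟦ a ⟧ *ℚ ⟦ agree (lowerMask L) s zeros ℕ.* onPath p ⟧) (cong level eq) ⟩
        ⟦ a ⟧ *ℚ ⟦ agree (lowerMask 0) s zeros ℕ.* onPath p ⟧
          ≡⟨ cong (λ m → ⟦ a ⟧ *ℚ ⟦ m ℕ.* onPath p ⟧) (agree-lowerMask-0 s zeros) ⟩
        ⟦ a ⟧ *ℚ ⟦ 1 ℕ.* onPath p ⟧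
          ≡⟨ ⟦⟧-homo-* a (1 ℕ.* onPath p) ⟨
        ⟦ a ℕ.* (1 ℕ.* onPath p) ⟧
          ≡⟨ cong ⟦_⟧ (trans (cong (a ℕ.*_) (ℕ.*-identityˡ (onPath p))) (ℕ.*-comm a (onPath p))) ⟩
        ⟦ onPath p ℕ.* a ⟧
          ∎
        where open ℚ-Solver.+-*-Solver using (solve; _:+_; _:*_; _:=_; con)

  ⟦⟧-sumℕ-eval : ⟦ sumℕ (allStates k) (eval D) ⟧ ≡ ⟦ normaliser ⟧
  ⟦⟧-sumℕ-eval = begin
    ⟦ sumℕ (allStates k) (eval D) ⟧
      ≡⟨ ⟦⟧-sumℕ (allStates k) (eval D) ⟩
    sumℚ (allStates k) (λ s → ⟦ eval D s ⟧)
      ≡⟨ sumℚ-cong (allStates k) (λ s → sym (𝔼-sampleADD-agree s)) ⟩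
    sumℚ (allStates k) (λ s → 𝔼 (sampleADD D) (G s) *ℚ ⟦ normaliser ⟧)
      ≡⟨ sumℚ-*ʳ (allStates k) (λ s → 𝔼 (sampleADD D) (G s)) ⟦ normaliser ⟧ ⟩
    sumℚ (allStates k) (λ s → 𝔼 (sampleADD D) (G s)) *ℚ ⟦ normaliser ⟧
      ≡⟨ cong (_*ℚ ⟦ normaliser ⟧) (sumℚ-𝔼 (allStates k) (sampleADD D) G) ⟩
    𝔼 (sampleADD D) (λ ω → sumℚ (allStates k) (λ s → G s ω)) *ℚ ⟦ normaliser ⟧
      ≡⟨ cong (_*ℚ ⟦ normaliser ⟧) (𝔼-cong (sampleADD D) (λ ω → trans (sym (⟦⟧-sumℕ (allStates k) (λ s → agree allTrue s ω)))
                                                                        (trans (cong ⟦_⟧ (sumℕ-allStates-agree k ω)) ⟦1⟧))) ⟩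
    𝔼 (sampleADD D) (λ _ → 1ℚ) *ℚ ⟦ totalLeafWeight ℕ.* 2 ℕ.^ (k ∸ lvl D (root D)) ⟧
      ≡⟨ cong (𝔼 (sampleADD D) (λ _ → 1ℚ) *ℚ_) (⟦⟧-homo-* totalLeafWeight (2 ℕ.^ (k ∸ lvl D (root D)))) ⟩
    𝔼 (sampleADD D) (λ _ → 1ℚ) *ℚ (⟦ totalLeafWeight ⟧ *ℚ ⟦ 2 ℕ.^ (k ∸ lvl D (root D)) ⟧)
      ≡⟨ ℚ.*-assoc (𝔼 (sampleADD D) (λ _ → 1ℚ)) ⟦ totalLeafWeight ⟧ _ ⟨
    𝔼 (sampleADD D) (λ _ → 1ℚ) *ℚ ⟦ totalLeafWeight ⟧ *ℚ ⟦ 2 ℕ.^ (k ∸ lvl D (root D)) ⟧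
      ≡⟨ cong (_*ℚ ⟦ 2 ℕ.^ (k ∸ lvl D (root D)) ⟧) 𝔼-sampleADD-1 ⟩
    ⟦ totalLeafWeight ⟧ *ℚ ⟦ 2 ℕ.^ (k ∸ lvl D (root D)) ⟧
      ≡⟨ ⟦⟧-homo-* totalLeafWeight (2 ℕ.^ (k ∸ lvl D (root D))) ⟨
    ⟦ normaliser ⟧
      ∎
    where
    open ≡-Reasoning
    G : State k → State k → ℚ
    G s ω = ⟦ agree allTrue s ω ⟧

sampleADD-distribution : ∀ {k} (D : ADD k) → WellFormedADD D → ∀ s →
  Pr (sampleADD D) (_≡ s) (_≟S s) *ℚ ⟦ sumℕ (allStates k) (eval D) ⟧ ≡ ⟦ eval D s ⟧
sampleADD-distribution D wf s = begin
  Pr (sampleADD D) (_≡ s) (_≟S s) *ℚ ⟦ sumℕ (allStates _) (eval D) ⟧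
    ≡⟨ cong₂ _*ℚ_ (trans (Pr≡𝔼 (sampleADD D) (_≡ s) (_≟S s)) (𝔼-cong (sampleADD D) (λ ω → indicator≡agree s ω))) ⟦⟧-sumℕ-eval ⟩
  𝔼 (sampleADD D) (λ ω → ⟦ agree allTrue s ω ⟧) *ℚ ⟦ normaliser ⟧
    ≡⟨ 𝔼-sampleADD-agree s ⟩
  ⟦ eval D s ⟧
    ∎
  where
  open ≡-Reasoning
  open WellFormed D wf

Pr-sampleFromADD-mid : ∀ {k} (D : ADD k) (s₁ s₃ s₂ : State k) →
  Pr (sampleFromADD D s₁ s₃) (midIs s₂) (midIs? s₂) ≡ Pr (sampleADD D) (_≡ s₂) (_≟S s₂)
Pr-sampleFromADD-mid D s₁ s₃ s₂ = begin
  Pr (sampleFromADD D s₁ s₃) (midIs s₂) (midIs? s₂)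
    ≡⟨ Pr≡𝔼 (sampleFromADD D s₁ s₃) (midIs s₂) (midIs? s₂) ⟩
  𝔼 (sampleADD D >>= λ m → return (s₁ , m , s₃)) (λ r → if does (midIs? s₂ r) then 1ℚ else 0ℚ)
    ≡⟨ 𝔼-bind (sampleADD D) (λ m → return (s₁ , m , s₃)) _ ⟩
  𝔼 (sampleADD D) (λ m → 𝔼 (return (s₁ , m , s₃)) (λ r → if does (midIs? s₂ r) then 1ℚ else 0ℚ))
    ≡⟨ 𝔼-cong (sampleADD D) (λ m → 𝔼-return (s₁ , m , s₃) (λ r → if does (midIs? s₂ r) then 1ℚ else 0ℚ)) ⟩
  𝔼 (sampleADD D) (λ m → if does (m ≟S s₂) then 1ℚ else 0ℚ)
    ≡⟨ Pr≡𝔼 (sampleADD D) (_≡ s₂) (_≟S s₂) ⟨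
  Pr (sampleADD D) (_≡ s₂) (_≟S s₂)
    ∎
  where open ≡-Reasoning

lemma6p4 : ∀ {k : ℕ} (t₀ : Trans k) (logN i : ℕ) → 1 ≤ i → i < logN →
    (s₁ s₃ : State k) → .{{_ : NonZero (c t₀ i s₁ s₃)}} →
    (tHat : ADD k) → WellFormedADD tHat →
    (∀ s → eval tHat s ≡ c t₀ (i ∸ 1) s₁ s * c t₀ (i ∸ 1) s s₃) →
    (s₂ : State k) →
    Pr (sampleFromADD tHat s₁ s₃) (midIs s₂) (midIs? s₂)
      ≡ (+ (c t₀ (i ∸ 1) s₁ s₂ * c t₀ (i ∸ 1) s₂ s₃)) / c t₀ i s₁ s₃
lemma6p4 {k} t₀ logN (suc i) _ _ s₁ s₃ tHat wf eval≡ s₂ =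
  trans (Pr-sampleFromADD-mid tHat s₁ s₃ s₂) (*⟦⟧≡⟦⟧⇒≡/ _ (c t₀ (suc i) s₁ s₃) (begin
    Pr (sampleADD tHat) (_≡ s₂) (_≟S s₂) *ℚ ⟦ sumℕ (allStates k) (λ s → c t₀ i s₁ s * c t₀ i s s₃) ⟧
      ≡⟨ cong (λ m → Pr (sampleADD tHat) (_≡ s₂) (_≟S s₂) *ℚ ⟦ m ⟧) (sumℕ-cong (allStates k) (sym ∘ eval≡)) ⟩
    Pr (sampleADD tHat) (_≡ s₂) (_≟S s₂) *ℚ ⟦ sumℕ (allStates k) (eval tHat) ⟧
      ≡⟨ sampleADD-distribution tHat wf s₂ ⟩
    ⟦ eval tHat s₂ ⟧
      ≡⟨ cong ⟦_⟧ (eval≡ s₂) ⟩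
    ⟦ c t₀ i s₁ s₂ * c t₀ i s₂ s₃ ⟧
      ∎))
  where open ≡-Reasoning
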